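{- Let $n\ge 2$ and $r,s\ge 1$ be integers and $k=2rs+r+s$. If $H\in\mathcal H_{2n}(2r+1,2s+1)$ (defined below), then $\chi_{la}(H)=3$.
   Context: For a graph $G$ with $q$ edges, a bijection $f:E(G)\to\{1,\dots,q\}$ is a local antimagic labeling if $f^+(u)\neq f^+(v)$ for every edge $uv$, where $f^+(u)$ is the sum of the labels of edges incident to $u$; $\chi_{la}(G)$ is the minimum number of distinct values of $f^+$ over all local antimagic labelings of $G$. Definition of $\mathcal G_{2n}(2r+1,2s+1)$ with its labeling. Let $D=8k+4$ (so $2k+1=(2r+1)(2s+1)$). Let $\Gamma$ be the graph with vertices $u_i,v_i,x_{i,j}$ ($1\le i\le 2k+1$, $1\le j\le 2n$) and edges $u_iv_i,u_ix_{i,j},v_ix_{i,j}$. Define $f:E(\Gamma)\to[1,(2k+1)(4n+1)]$: for $1\le i\le k+1$: $f(u_iv_i)=i$, $f(u_ix_{i,2n-1})=10k+7-2i$, $f(u_ix_{i,2n})=5k+2+i$, $f(v_ix_{i,1})=3k+1+i$, $f(v_ix_{i,2})=8k+6-2i$, and for $t\in\{2,\dots,n\}$: $f(u_ix_{i,2n-2t+1})=k+2-i+tD$, $f(u_ix_{i,2n-2t+2})=-3k-2+i+tD$, $f(v_ix_{i,2t-1})=-5k-3+i+tD$, $f(v_ix_{i,2t})=-k+1-i+tD$. For $k+2\le i\le 2k+1$: $f(u_iv_i)=i$, $f(u_ix_{i,2n-1})=12k+8-2i$, $f(u_ix_{i,2n})=3k+1+i$, $f(v_ix_{i,1})=k+i$,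 $f(v_ix_{i,2})=10k+7-2i$, and for $t\in\{2,\dots,n\}$: $f(u_ix_{i,2n-2t+1})=3k+3-i+tD$, $f(u_ix_{i,2n-2t+2})=-5k-3+i+tD$, $f(v_ix_{i,2t-1})=-7k-4+i+tD$, $f(v_ix_{i,2t})=k+2-i+tD$. Let $\sigma_j(i)=f(u_ix_{i,j})+f(v_ix_{i,j})$. A graph in $\mathcal G_{2n}(2r+1,2s+1)$ is obtained from $\Gamma$ by choosing, for each $j\in[1,2n]$ independently, a partition of $\{1,\dots,2k+1\}$ into $2r+1$ blocks of size $2s+1$ with $\sum_{i\in B}\sigma_j(i)=(2s+1)[(4k+3)+n(8k+4)]$ for each block $B$, and identifying, for each $j$ and block $B$, the vertices $x_{i,j}$ ($i\in B$) into one vertex (of degree $4s+2$); edge labels are inherited from $f$. Definition of $\mathcal H_{2n}(2r+1,2s+1)$. Given such a graph with its edge labeling $f$, a delete-add operation is: choose two distinct vertices $x,x'$ of degree $4s+2$ (merged vertices) and indices $i,i'$ such that $x$ is adjacent to $u_i,v_i$, $x'$ is adjacent to $u_{i'},v_{i'}$, $f(xu_i)+f(xv_i)=f(x'u_{i'})+f(x'v_{i'})=(4k+3)+n(8k+4)$, and $x,x'$ have no common neighbor; delete the edges $xu_i,xv_i,x'u_{i'},x'v_{i'}$ and add edges $xu_{i'},xv_{i'}$ with labels $f(x'u_{i'}),f(x'v_{i'})$ respectively and edges $x'u_i,x'v_i$ with labels $f(xu_i),f(xv_i)$ respectively. $\mathcal H_{2n}(2r+1,2s+1)$ is the set of graphs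 obtained from graphs in $\mathcal G_{2n}(2r+1,2s+1)$ by applying one or more successive delete-add operations (each with respect to the current graph and labeling). Such graphs may be disconnected. -}

module Defs where

open import Data.Nat as ℕ using (ℕ; zero; suc; _≤ᵇ_; _≤_)
open import Data.Nat.DivMod using (_/_; _%_)
open import Data.Integer as ℤ using (ℤ; +_)
open import Data.Bool using (Bool; true; false; if_then_else_)
open import Data.Fin as Fin using (Fin; toℕ)
open import Data.Fin.Properties using () renaming (_≟_ to _≟F_)
open import Data.Nat.ListAction using (sum)
open import Data.List using (List; []; _∷_; _++_; map; concatMap; length; lookup; foldr; allFin; filter; deduplicate; cartesianProduct)
open import Data.Product using (Σ; ∃; _×_; _,_; proj₁; proj₂)
open import Data.Sum using (_⊎_; inj₁; inj₂)
import Data.Sum.Properties as SumP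
import Data.Product.Properties as ProdP
open import Relation.Nullary using (¬_; Dec; does)
open import Relation.Binary.Definitions using (DecidableEquality)
open import Relation.Binary.PropositionalEquality using (_≡_; _≢_)
open import Relation.Binary.Construct.Closure.Transitive using (TransClosure)
open import Function.Bundles using (_⤖_; Bijection)

record Graph : Set₁ where
  field
    Vertex   : Set
    _≟V_     : DecidableEquality Vertex
    vertices : List Vertex
    edges    : List (Vertex × Vertex)

module _ (G : Graph) where
  open Graph G

  q : ℕ
  q = length edges

  Edge : Set
  Edge = Fin q

  endpoints : Edge → Vertex × Vertex
  endpoints e = lookup edges e

  -- an edge labeling is a bijection E(G) → {1,…,q}; label e = 1 + to e
  Labeling : Set
  Labeling = Edge ⤖ Fin q

  label : Labeling → Edge → ℕ
  label f e = suc (toℕ (Bijection.to f e))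

  incident : Vertex → Edge → Bool
  incident w e = does (w ≟V proj₁ (endpoints e)) Data.Bool.∨ does (w ≟V proj₂ (endpoints e))
    where import Data.Bool

  vsum : Labeling → Vertex → ℕ
  vsum f w = sum (map (λ e → if incident w e then label f e else 0) (allFin q))

  IsLocalAntimagic : Labeling → Set
  IsLocalAntimagic f = (e : Edge) → vsum f (proj₁ (endpoints e)) ≢ vsum f (proj₂ (endpoints e))

  numValues : Labeling → ℕ
  numValues f = length (deduplicate ℕ._≟_ (map (vsum f) vertices))

  χla≡ : ℕ → Set
  χla≡ c = (Σ Labeling λ f → IsLocalAntimagic f × numValues f ≡ c)
         × ((f : Labeling) → IsLocalAntimagic f → c ≤ numValues f)

-- The labeling f of Γ (values as integers; 1-based vertex index i).
-- For an edge u_i x_{i,j} or v_i x_{i,j}, t is the parameter in the paper's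
-- formulas and `first` says whether j is odd (j = 2n-2t+1 resp. j = 2t-1).

D : ℕ → ℤ
D k = + (8 ℕ.* k ℕ.+ 4)

fU : (k i t : ℕ) → Bool → ℤ
fU k i t first =
  if i ≤ᵇ suc k
  then (if t ≤ᵇ 1
        then (if first then + (10 ℕ.* k ℕ.+ 7) ℤ.- + (2 ℕ.* i) else + (5 ℕ.* k ℕ.+ 2 ℕ.+ i))
        else (if first then + (k ℕ.+ 2) ℤ.- + i ℤ.+ + t ℤ.* D k
                       else + i ℤ.- + (3 ℕ.* k ℕ.+ 2) ℤ.+ + t ℤ.* D k))
  else (if t ≤ᵇ 1
        then (if first then + (12 ℕ.* k ℕ.+ 8) ℤ.- + (2 ℕ.* i) else + (3 ℕ.* k ℕ.+ 1 ℕ.+ i))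
        else (if first then + (3 ℕ.* k ℕ.+ 3) ℤ.- + i ℤ.+ + t ℤ.* D k
                       else + i ℤ.- + (5 ℕ.* k ℕ.+ 3) ℤ.+ + t ℤ.* D k))

fV : (k i t : ℕ) → Bool → ℤ
fV k i t first =
  if i ≤ᵇ suc k
  then (if t ≤ᵇ 1
        then (if first then + (3 ℕ.* k ℕ.+ 1 ℕ.+ i) else + (8 ℕ.* k ℕ.+ 6) ℤ.- + (2 ℕ.* i))
        else (if first then + i ℤ.- + (5 ℕ.* k ℕ.+ 3) ℤ.+ + t ℤ.* D k
                       else + 1 ℤ.- + k ℤ.- + i ℤ.+ + t ℤ.* D k))
  else (if t ≤ᵇ 1
        then (if first then + (k ℕ.+ i) else + (10 ℕ.* k ℕ.+ 7) ℤ.- + (2 ℕ.* i))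
        else (if first then + i ℤ.- + (7 ℕ.* k ℕ.+ 4) ℤ.+ + t ℤ.* D k
                       else + (k ℕ.+ 2) ℤ.- + i ℤ.+ + t ℤ.* D k))

-- Index sets: i ∈ Fin (2k+1) stands for i = toℕ i + 1,
-- j ∈ Fin (2n) stands for j = toℕ j + 1.
Idx : ℕ → Set
Idx k = Fin (suc (2 ℕ.* k))

JIdx : ℕ → Set
JIdx n = Fin (2 ℕ.* n)

isOddJ : (n : ℕ) → JIdx n → Bool   -- 1-based j odd
isOddJ n j = toℕ j % 2 ℕ.≡ᵇ 0

labU : (k n : ℕ) → Idx k → JIdx n → ℤ
labU k n i j = fU k (suc (toℕ i)) (n ℕ.∸ (toℕ j / 2)) (isOddJ n j)

labV : (k n : ℕ) → Idx k → JIdx n → ℤ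
labV k n i j = fV k (suc (toℕ i)) (suc (toℕ j / 2)) (isOddJ n j)

σ : (k n : ℕ) → JIdx n → Idx k → ℤ
σ k n j i = labU k n i j ℤ.+ labV k n i j

sumℤ : List ℤ → ℤ
sumℤ = foldr ℤ._+_ (+ 0)

Tgt : (k n : ℕ) → ℤ
Tgt k n = + (4 ℕ.* k ℕ.+ 3 ℕ.+ n ℕ.* (8 ℕ.* k ℕ.+ 4))

-- The merged vertices are named by (j , b): the block b ∈ Fin (2r+1) of
-- the partition chosen for column j.  A configuration X assigns to every
-- "slot" (i , j) (carrying the two edges u_i x, v_i x with the fixed labels
-- labU i j, labV i j) the merged vertex x = X i j it is attached to.

MVert : (n r : ℕ) → Set
MVert n r = JIdx n × Fin (suc (2 ℕ.* r))

Config : (k n r : ℕ) → Set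
Config k n r = Idx k → JIdx n → MVert n r

decM : (n r : ℕ) → DecidableEquality (MVert n r)
decM n r = ProdP.≡-dec _≟F_ _≟F_

Partition : (k n r : ℕ) → Set
Partition k n r = JIdx n → Idx k → Fin (suc (2 ℕ.* r))

block : (k n r : ℕ) → Partition k n r → JIdx n → Fin (suc (2 ℕ.* r)) → List (Idx k)
block k n r π j b = filter (λ i → π j i ≟F b) (allFin _)

ValidPartition : (k n r s : ℕ) → Partition k n r → Set
ValidPartition k n r s π =
  (j : JIdx n) (b : Fin (suc (2 ℕ.* r))) →
    (length (block k n r π j b) ≡ suc (2 ℕ.* s))
    × (sumℤ (map (σ k n j) (block k n r π j b)) ≡ + (suc (2 ℕ.* s)) ℤ.* Tgt k n)

-- graph of 𝒢 obtained from Γ by the identifications given by π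
initConfig : (k n r : ℕ) → Partition k n r → Config k n r
initConfig k n r π i j = (j , π j i)

Adj : (k n r : ℕ) → Config k n r → Idx k → MVert n r → Set
Adj k n r X i x = ∃ λ j → X i j ≡ x

CommonNeighbour : (k n r : ℕ) → Config k n r → MVert n r → MVert n r → Set
CommonNeighbour k n r X x x' = ∃ λ i → Adj k n r X i x × Adj k n r X i x'

swapSlots : (k n r : ℕ) → Config k n r → Idx k → JIdx n → Idx k → JIdx n → Config k n r
swapSlots k n r X i j i' j' a b with does (a ≟F i) Data.Bool.∧ does (b ≟F j)
  where import Data.Bool
... | true = X i' j'
... | false with does (a ≟F i') Data.Bool.∧ does (b ≟F j')
  where import Data.Bool
...   | true = X i j
...   | false = X a b

-- one delete-add operation: x = X i j (adjacent to u_i, v_i through slot (i,j)),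
-- x' = X i' j'; afterwards slot (i',j') is attached to x and slot (i,j) to x'.
data DeleteAdd (k n r : ℕ) : Config k n r → Config k n r → Set where
  delAdd : (X : Config k n r) (i : Idx k) (j : JIdx n) (i' : Idx k) (j' : JIdx n) →
           X i j ≢ X i' j' →
           σ k n j i ≡ Tgt k n →
           σ k n j' i' ≡ Tgt k n →
           ¬ CommonNeighbour k n r X (X i j) (X i' j') →
           DeleteAdd k n r X (swapSlots k n r X i j i' j')

-- the underlying graph of a configuration: vertices u_i, v_i, merged x;
-- edges u_i v_i and, for every slot (i,j), u_i (X i j) and v_i (X i j).
VertH : (k n r : ℕ) → Set
VertH k n r = Idx k ⊎ (Idx k ⊎ MVert n r)

graphOf : (k n r : ℕ) → Config k n r → Graph
graphOf k n r X = record
  { Vertex   = VertH k n r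
  ; _≟V_     = SumP.≡-dec _≟F_ (SumP.≡-dec _≟F_ (decM n r))
  ; vertices = map inj₁ (allFin _) ++ map (λ i → inj₂ (inj₁ i)) (allFin _)
               ++ map (λ x → inj₂ (inj₂ x)) (cartesianProduct (allFin _) (allFin _))
  ; edges    = concatMap (λ i → (inj₁ i , inj₂ (inj₁ i))
                 ∷ concatMap (λ j → (inj₁ i , inj₂ (inj₂ (X i j)))
                                  ∷ (inj₂ (inj₁ i) , inj₂ (inj₂ (X i j))) ∷ [])
                             (allFin _))
               (allFin _)
  }

InH : (k n r s : ℕ) → Config k n r → Set
InH k n r s X = Σ (Partition k n r) λ π →
  ValidPartition k n r s π × TransClosure (DeleteAdd k n r) (initConfig k n r π) X

-- Number the rungs u_i v_i by i and every spoke by 1 + ρ(i) + (2k+1)·Q, where ρ is one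
-- of the permutations i ↦ i + k, k − i, 2(k − i) of ℤ/(2k+1) and Q ∈ [1, 4n] records the
-- side of the spoke, the parity of j and the paper's parameter t; these are exactly the
-- paper's labels, so the labelling is a bijection onto [1, (2k+1)(4n+1)].  Summing the
-- spokes with the same t in pairs, every u_i receives (8k+4)n² + (6k+4)n + k + 1 and every
-- v_i receives (8k+4)n² + (2k+2)n + k + 1.  A merged vertex receives (2s+1)·T with
-- T = (4k+3) + n(8k+4): this holds for the partitions defining 𝒢 and survives every
-- delete-add operation, which only exchanges two slots of weight T.  The three values are
-- distinct, the first two lying strictly between consecutive multiples of T, so the
-- labelling is local antimagic with three values; the triangle u_1 v_1 x_{1,1} forces three.

module Submission where

open import Data.Bool using (Bool; true; false; T; if_then_else_; _∧_; _∨_)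
open import Data.Bool.Properties using (∨-zeroʳ)
open import Data.Empty using (⊥-elim)
open import Data.Fin using (Fin; toℕ; zero; suc; punchIn; punchOut; fromℕ<)
open import Data.Fin.Properties
  using (toℕ<n; toℕ-injective; toℕ-inject₁; toℕ-fromℕ; toℕ-fromℕ<; punchInᵢ≢i; punchOut-injective;
         injective⇒≤; any?)
  renaming (_≟_ to _≟F_)
open import Data.Integer as ℤ using (ℤ; +_)
open import Data.Integer.Properties using (m-n≡m⊖n; ⊖-≥; pos-*; pos-+) renaming (+-injective to pos-injective)
import Data.Integer.Tactic.RingSolver as ℤ-Solver
open import Data.List
  using (List; []; _∷_; _++_; map; length; lookup; filter; allFin; tabulate; concatMap; deduplicate;
         cartesianProduct; cartesianProductWith)
open import Data.List.Membership.Propositional using (_∈_)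
open import Data.List.Membership.Propositional.Properties
  using (∈-filter⁺; ∈-filter⁻; ∈-deduplicate⁺; ∈-deduplicate⁻; ∈-map⁺; ∈-map⁻; ∈-++⁺ˡ; ∈-++⁺ʳ;
         ∈-allFin; ∈-cartesianProduct⁺; ∈-cartesianProductWith⁻)
open import Data.List.Membership.Propositional.Properties.WithK using (unique∧set⇒bag)
open import Data.List.Properties
  using (map-tabulate; map-cong; map-∘; map-++; concatMap-cong; length-++; length-map; length-tabulate; length-filter)
open import Data.List.Relation.Binary.BagAndSetEquality using (∼bag⇒↭)
open import Data.List.Relation.Binary.Permutation.Propositional.Properties using (↭-length)
open import Data.List.Relation.Binary.Subset.Propositional using (_⊆_)
open import Data.List.Relation.Unary.All as ListAll using (All)
import Data.List.Relation.Unary.AllPairs as AllPairs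
open import Data.List.Relation.Unary.Any using (here; there)
open import Data.List.Relation.Unary.Unique.Propositional using (Unique)
open import Data.List.Relation.Unary.Unique.Propositional.Properties
  using (filter⁺; cartesianProduct⁺; cartesianProductWith⁺; allFin⁺)
import Data.Nat as ℕ
open import Data.Nat using (ℕ; zero; suc; _+_; _*_; _∸_; _<_; _≤_; _<ᵇ_; _≡ᵇ_; s≤s; z≤n; z<s; s<s; s≤s⁻¹)
open import Data.Nat.DivMod using (_/_; _%_; m≡m%n+[m/n]*n; m%n<n; m<n⇒m%n≡m; [m+kn]%n≡m%n)
import Data.Nat.ListAction as List
import Data.Nat.ListAction.Properties as List
open import Data.Nat.Properties
open import Algebra.Properties.CommutativeMonoid.Sum +-0-commutativeMonoid
  using (sum-syntax; sum-cong-≗; sum-init-last; sum-remove; sum-replicate-zero)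
open import Data.Nat.Tactic.RingSolver using (solve; solve-∀)
open import Data.Product using (∃; _×_; _,_; proj₁; proj₂)
open import Data.Product.Properties using (,-injectiveˡ; ,-injectiveʳ; ≡-dec)
open import Data.Sum using (inj₁; inj₂)
open import Data.Sum.Properties using (inj₁-injective; inj₂-injective)
open import Data.Unit using (tt)
open import Function using (id; _∘_; _∘′_)
open import Function.Bundles using (_⇔_; mk⇔; mk⤖)
open import Relation.Binary.Construct.Closure.Transitive using (TransClosure; [_]) renaming (_∷_ to _∷⁺_)
open import Relation.Binary.Definitions using (DecidableEquality)
open import Relation.Binary.PropositionalEquality
open import Relation.Nullary using (yes; no; does)
open import Relation.Nullary.Decidable using (dec-true; dec-false)
open import Relation.Unary using (Decidable)

open import Defs
  using (Graph; Labeling; Edge; endpoints; label; incident; vsum; numValues; IsLocalAntimagic; χla≡;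
         fU; fV; Idx; JIdx; labU; labV; σ; sumℤ; Tgt; MVert; Config; decM; ValidPartition;
         block; initConfig; swapSlots; DeleteAdd; delAdd; VertH; graphOf; InH)

divMod-unique : ∀ {w r r′ q q′} → r < w → r′ < w → r + q * w ≡ r′ + q′ * w → r ≡ r′ × q ≡ q′
divMod-unique {suc w} {r} {r′} {q} {q′} r<w r′<w eq = r≡r′ , *-cancelʳ-≡ q q′ (suc w) (+-cancelˡ-≡ r _ _ qw≡q′w)
  where
  r≡r′ : r ≡ r′
  r≡r′ = begin
    r                          ≡⟨ m<n⇒m%n≡m r<w ⟨
    r % suc w                  ≡⟨ [m+kn]%n≡m%n r q (suc w) ⟨
    (r + q * suc w) % suc w    ≡⟨ cong (_% suc w) eq ⟩
    (r′ + q′ * suc w) % suc w  ≡⟨ [m+kn]%n≡m%n r′ q′ (suc w) ⟩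
    r′ % suc w                 ≡⟨ m<n⇒m%n≡m r′<w ⟩
    r′                         ∎
    where open ≡-Reasoning
  qw≡q′w : r + q * suc w ≡ r + q′ * suc w
  qw≡q′w = trans eq (cong (λ x → x + q′ * suc w) (sym r≡r′))

halving : ∀ {r} x → r < 2 → (r + x * 2) % 2 ≡ r × (r + x * 2) / 2 ≡ x
halving {r} x r<2 = divMod-unique (m%n<n (r + x * 2) 2) r<2 (sym (m≡m%n+[m/n]*n (r + x * 2) 2))

∸≡suc∸suc : ∀ {m l} → m < l → l ∸ m ≡ suc (l ∸ suc m)
∸≡suc∸suc {zero}  {suc l} _          = refl
∸≡suc∸suc {suc m} {suc l} (s≤s m<l) = ∸≡suc∸suc m<l

between-multiples⇒≢multiple : ∀ {x c m r r′} → x ≡ c * m + suc r → m ≡ suc r + suc r′ → ∀ d → x ≢ d * m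
between-multiples⇒≢multiple {x} {c} {m} {r} {r′} x≡ m≡ d x≡dm =
  <⇒≱ (*-cancelʳ-< m d (suc c) dm<[1+c]m) (*-cancelʳ-< m c d cm<dm)
  where
  cm<dm : c * m < d * m
  cm<dm = begin-strict
    c * m          <⟨ m<m+n (c * m) z<s ⟩
    c * m + suc r  ≡⟨ trans (sym x≡) x≡dm ⟩
    d * m          ∎
    where open ≤-Reasoning
  dm<[1+c]m : d * m < suc c * m
  dm<[1+c]m = begin-strict
    d * m                    ≡⟨ trans (sym x≡dm) x≡ ⟩
    c * m + suc r            <⟨ +-monoʳ-< (c * m) (m<m+n (suc r) z<s) ⟩
    c * m + (suc r + suc r′) ≡⟨ cong (λ z → c * m + z) m≡ ⟨
    c * m + m                ≡⟨ +-comm (c * m) m ⟩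
    suc c * m                ∎
    where open ≤-Reasoning

-- Three permutations of ℤ/(2k+1)

W : ℕ → ℕ
W k = suc (2 * k)

-- The maps i ↦ i + k, k − i and 2(k − i) modulo 2k + 1, written out on the
-- halves i ≤ k and k < i ≤ 2k (the test is the one used in the paper's labels).
shift reflect doubleReflect : ℕ → ℕ → ℕ
shift k i with i <ᵇ suc k
... | true  = k + i
... | false = i ∸ suc k
reflect k i with i <ᵇ suc k
... | true  = k ∸ i
... | false = suc k + (2 * k ∸ i)
doubleReflect k i with i <ᵇ suc k
... | true  = 2 * (k ∸ i)
... | false = suc (2 * (2 * k ∸ i))

data Half (k i : ℕ) : Set where
  low  : (a : ℕ) → i + a ≡ k → (i <ᵇ suc k) ≡ true → Half k i
  high : (e d : ℕ) → suc k + e ≡ i → suc e + d ≡ k → (i <ᵇ suc k) ≡ false → Half k i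

private
  suc-e<k : ∀ {k e} → suc k + e < W k → suc e ≤ k
  suc-e<k {k} {e} lt = +-cancelˡ-≤ k (suc e) k (begin
    k + suc e   ≡⟨ +-suc k e ⟩
    suc k + e   ≤⟨ s≤s⁻¹ lt ⟩
    2 * k       ≡⟨ solve (k ∷ []) ⟩
    k + k       ∎)
    where open ≤-Reasoning

half : ∀ k i → i < W k → Half k i
half k i i<W with i <ᵇ suc k in isLow
... | true = let (a , i+a≡k) = m≤n⇒∃[o]m+o≡n (s≤s⁻¹ (<ᵇ⇒< i (suc k) (subst T (sym isLow) tt)))
             in low a i+a≡k isLow
... | false with e , refl ← m≤n⇒∃[o]m+o≡n {suc k} {i} (≮⇒≥ (λ i≤k → subst T isLow (<⇒<ᵇ i≤k)))
  = let (d , e+d≡k) = m≤n⇒∃[o]m+o≡n (suc-e<k i<W) in high e d refl e+d≡k isLow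

module _ (k i : ℕ) where

  shift-low : (i <ᵇ suc k) ≡ true → shift k i ≡ k + i
  shift-low isLow rewrite isLow = refl

  reflect-low : ∀ {a} → i + a ≡ k → (i <ᵇ suc k) ≡ true → reflect k i ≡ a
  reflect-low {a} refl isLow rewrite isLow = m+n∸m≡n i a

  doubleReflect-low : ∀ {a} → i + a ≡ k → (i <ᵇ suc k) ≡ true → doubleReflect k i ≡ 2 * a
  doubleReflect-low {a} refl isLow rewrite isLow = cong (2 *_) (m+n∸m≡n i a)

  shift-high : ∀ {e} → suc k + e ≡ i → (i <ᵇ suc k) ≡ false → shift k i ≡ e
  shift-high {e} refl isHigh rewrite isHigh = m+n∸m≡n (suc k) e

  2k∸i≡d : ∀ {e d} → suc k + e ≡ i → suc e + d ≡ k → 2 * k ∸ i ≡ d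
  2k∸i≡d {e} {d} refl refl = trans (cong (_∸ (suc (suc e + d) + e)) 2k≡i+d) (m+n∸m≡n (suc (suc e + d) + e) d)
    where
    2k≡i+d : 2 * (suc e + d) ≡ suc (suc e + d) + e + d
    2k≡i+d = solve (e ∷ d ∷ [])

  reflect-high : ∀ {e d} → suc k + e ≡ i → suc e + d ≡ k → (i <ᵇ suc k) ≡ false → reflect k i ≡ suc k + d
  reflect-high k+e≡i e+d≡k isHigh rewrite isHigh = cong (_+_ (suc k)) (2k∸i≡d k+e≡i e+d≡k)

  doubleReflect-high : ∀ {e d} → suc k + e ≡ i → suc e + d ≡ k → (i <ᵇ suc k) ≡ false →
                       doubleReflect k i ≡ suc (2 * d)
  doubleReflect-high k+e≡i e+d≡k isHigh rewrite isHigh = cong (λ x → suc (2 * x)) (2k∸i≡d k+e≡i e+d≡k)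

shift+reflect : ∀ k i → i < W k → shift k i + reflect k i ≡ 2 * k
shift+reflect k i i<W with half k i i<W
... | low a refl isLow = begin
  shift (i + a) i + reflect (i + a) i
    ≡⟨ cong₂ _+_ (shift-low (i + a) i isLow) (reflect-low (i + a) i refl isLow) ⟩
  (i + a) + i + a  ≡⟨ solve (i ∷ a ∷ []) ⟩
  2 * (i + a)      ∎
  where open ≡-Reasoning
... | high e d refl refl isHigh = begin
  shift K I + reflect K I    ≡⟨ cong₂ _+_ (shift-high K I refl isHigh) (reflect-high K I refl refl isHigh) ⟩
  e + (suc (suc e + d) + d)  ≡⟨ solve (e ∷ d ∷ []) ⟩
  2 * (suc e + d)            ∎
  where
  open ≡-Reasoning
  K I : ℕ
  K = suc e + d
  I = suc K + e

doubleReflect+shift+i : ∀ k i → i < W k → doubleReflect k i + shift k i + i ≡ 3 * k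
doubleReflect+shift+i k i i<W with half k i i<W
... | low a refl isLow = begin
  doubleReflect (i + a) i + shift (i + a) i + i
    ≡⟨ cong₂ (λ x y → x + y + i) (doubleReflect-low (i + a) i refl isLow) (shift-low (i + a) i isLow) ⟩
  2 * a + (i + a + i) + i  ≡⟨ solve (i ∷ a ∷ []) ⟩
  3 * (i + a)              ∎
  where open ≡-Reasoning
... | high e d refl refl isHigh = begin
  doubleReflect K I + shift K I + I
    ≡⟨ cong₂ (λ x y → x + y + I) (doubleReflect-high K I refl refl isHigh) (shift-high K I refl isHigh) ⟩
  suc (2 * d) + e + (suc (suc e + d) + e)  ≡⟨ solve (e ∷ d ∷ []) ⟩
  3 * (suc e + d)                          ∎
  where
  open ≡-Reasoning
  K I : ℕ
  K = suc e + d
  I = suc K + e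

private
  k+i≢e : ∀ {k i e d} → suc e + d ≡ k → k + i ≢ e
  k+i≢e {i = i} {e} {d} refl eq = <⇒≢ (s≤s (≤-trans (m≤m+n e d) (m≤m+n (e + d) i))) (sym eq)

shift-injective : ∀ k {i i′} → i < W k → i′ < W k → shift k i ≡ shift k i′ → i ≡ i′
shift-injective k {i} {i′} i<W i′<W eq with half k i i<W | half k i′ i′<W
... | low _ _ isLow | low _ _ isLow′ =
  +-cancelˡ-≡ k i i′ (trans (sym (shift-low k i isLow)) (trans eq (shift-low k i′ isLow′)))
... | high e _ k+e≡i _ isHigh | high e′ _ k+e′≡i′ _ isHigh′ =
  trans (sym k+e≡i) (trans (cong (_+_ (suc k)) e≡e′) k+e′≡i′)
  where
  e≡e′ : e ≡ e′
  e≡e′ = trans (sym (shift-high k i k+e≡i isHigh)) (trans eq (shift-high k i′ k+e′≡i′ isHigh′))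
... | low _ _ isLow | high _ _ k+e′≡i′ e′+d′≡k isHigh′ =
  ⊥-elim (k+i≢e e′+d′≡k (trans (sym (shift-low k i isLow)) (trans eq (shift-high k i′ k+e′≡i′ isHigh′))))
... | high _ _ k+e≡i e+d≡k isHigh | low _ _ isLow′ =
  ⊥-elim (k+i≢e e+d≡k (trans (sym (shift-low k i′ isLow′)) (trans (sym eq) (shift-high k i k+e≡i isHigh))))

reflect-injective : ∀ k {i i′} → i < W k → i′ < W k → reflect k i ≡ reflect k i′ → i ≡ i′
reflect-injective k {i} {i′} i<W i′<W eq = shift-injective k i<W i′<W (+-cancelʳ-≡ _ (shift k i) (shift k i′) (begin
  shift k i + reflect k i    ≡⟨ shift+reflect k i i<W ⟩
  2 * k                      ≡⟨ shift+reflect k i′ i′<W ⟨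
  shift k i′ + reflect k i′  ≡⟨ cong (_+_ (shift k i′)) eq ⟨
  shift k i′ + reflect k i   ∎))
  where open ≡-Reasoning

doubleReflect-injective : ∀ k {i i′} → i < W k → i′ < W k → doubleReflect k i ≡ doubleReflect k i′ → i ≡ i′
doubleReflect-injective k {i} {i′} i<W i′<W eq with half k i i<W | half k i′ i′<W
... | low a i+a≡k isLow | low a′ i′+a′≡k isLow′ =
  +-cancelʳ-≡ a i i′ (trans i+a≡k (trans (sym i′+a′≡k) (cong (_+_ i′) (sym a≡a′))))
  where
  a≡a′ : a ≡ a′
  a≡a′ = *-cancelˡ-≡ a a′ 2 (trans (sym (doubleReflect-low k i i+a≡k isLow))
                                    (trans eq (doubleReflect-low k i′ i′+a′≡k isLow′)))
... | high e d k+e≡i e+d≡k isHigh | high e′ d′ k+e′≡i′ e′+d′≡k isHigh′ =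
  trans (sym k+e≡i) (trans (cong (_+_ (suc k)) e≡e′) k+e′≡i′)
  where
  d≡d′ : d ≡ d′
  d≡d′ = *-cancelˡ-≡ d d′ 2 (suc-injective (trans (sym (doubleReflect-high k i k+e≡i e+d≡k isHigh))
                                                  (trans eq (doubleReflect-high k i′ k+e′≡i′ e′+d′≡k isHigh′))))
  e≡e′ : e ≡ e′
  e≡e′ = +-cancelʳ-≡ d e e′ (suc-injective (trans e+d≡k (trans (sym e′+d′≡k) (cong (_+_ (suc e′)) (sym d≡d′)))))
... | low a i+a≡k isLow | high e′ d′ k+e′≡i′ e′+d′≡k isHigh′ =
  ⊥-elim (even≢odd a d′ (trans (sym (doubleReflect-low k i i+a≡k isLow))
                               (trans eq (doubleReflect-high k i′ k+e′≡i′ e′+d′≡k isHigh′))))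
... | high e d k+e≡i e+d≡k isHigh | low a′ i′+a′≡k isLow′ =
  ⊥-elim (even≢odd a′ d (trans (sym (doubleReflect-low k i′ i′+a′≡k isLow′))
                               (trans (sym eq) (doubleReflect-high k i k+e≡i e+d≡k isHigh))))

shift<W : ∀ k i → i < W k → shift k i < W k
shift<W k i i<W = s≤s (≤-trans (m≤m+n (shift k i) (reflect k i)) (≤-reflexive (shift+reflect k i i<W)))

reflect<W : ∀ k i → i < W k → reflect k i < W k
reflect<W k i i<W = s≤s (≤-trans (m≤n+m (reflect k i) (shift k i)) (≤-reflexive (shift+reflect k i i<W)))

doubleReflect<W : ∀ k i → i < W k → doubleReflect k i < W k
doubleReflect<W k i i<W with half k i i<W
... | low a i+a≡k isLow = begin-strict
  doubleReflect k i  ≡⟨ doubleReflect-low k i i+a≡k isLow ⟩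
  2 * a              ≤⟨ *-monoʳ-≤ 2 (≤-trans (m≤n+m a i) (≤-reflexive i+a≡k)) ⟩
  2 * k              <⟨ n<1+n (2 * k) ⟩
  W k                ∎
  where open ≤-Reasoning
... | high e d k+e≡i e+d≡k isHigh = begin-strict
  doubleReflect k i  ≡⟨ doubleReflect-high k i k+e≡i e+d≡k isHigh ⟩
  suc (2 * d)        <⟨ s≤s (*-monoʳ-< 2 (≤-trans (s≤s (m≤n+m d e)) (≤-reflexive e+d≡k))) ⟩
  W k                ∎
  where open ≤-Reasoning

data Side : Set where
  u v : Side

-- b is the parity of the 0-based j (so b = 0 is the paper's odd j) and τ = t − 1.
residue : Side → (b τ : ℕ) → ℕ → ℕ → ℕ
residue u zero    zero    = doubleReflect
residue u zero    (suc _) = reflect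
residue u (suc _) _       = shift
residue v zero    _       = shift
residue v (suc _) zero    = doubleReflect
residue v (suc _) (suc _) = reflect

offset : Side → ℕ → ℕ
offset u zero    = 3
offset u (suc _) = 1
offset v zero    = 0
offset v (suc _) = 2

offset≤3 : ∀ s b → offset s b ≤ 3
offset≤3 u zero    = ≤-refl
offset≤3 u (suc _) = s≤s z≤n
offset≤3 v zero    = z≤n
offset≤3 v (suc _) = s≤s (s≤s z≤n)

offset⁻¹ : ℕ → Side × ℕ
offset⁻¹ 0 = v , 0
offset⁻¹ 1 = u , 1
offset⁻¹ 2 = v , 1
offset⁻¹ _ = u , 0

offset⁻¹-offset : ∀ s {b} → b < 2 → offset⁻¹ (offset s b) ≡ (s , b)
offset⁻¹-offset u {0} _ = refl
offset⁻¹-offset u {1} _ = refl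
offset⁻¹-offset v {0} _ = refl
offset⁻¹-offset v {1} _ = refl
offset⁻¹-offset _ {suc (suc _)} (s≤s (s≤s ()))

offset-injective : ∀ {s s′ b b′} → b < 2 → b′ < 2 → offset s b ≡ offset s′ b′ → s ≡ s′ × b ≡ b′
offset-injective {s} {s′} {b} {b′} b<2 b′<2 eq = ,-injectiveˡ sb≡s′b′ , ,-injectiveʳ sb≡s′b′
  where
  sb≡s′b′ : (s , b) ≡ (s′ , b′)
  sb≡s′b′ = trans (sym (offset⁻¹-offset s b<2)) (trans (cong offset⁻¹ eq) (offset⁻¹-offset s′ b′<2))

residue<W : ∀ k s b τ {i} → i < W k → residue s b τ k i < W k
residue<W k u zero    zero    = doubleReflect<W k _
residue<W k u zero    (suc _) = reflect<W k _
residue<W k u (suc _) _       = shift<W k _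
residue<W k v zero    _       = shift<W k _
residue<W k v (suc _) zero    = doubleReflect<W k _
residue<W k v (suc _) (suc _) = reflect<W k _

residue-injective : ∀ k s b τ {i i′} → i < W k → i′ < W k → residue s b τ k i ≡ residue s b τ k i′ → i ≡ i′
residue-injective k u zero    zero    = doubleReflect-injective k
residue-injective k u zero    (suc _) = reflect-injective k
residue-injective k u (suc _) _       = shift-injective k
residue-injective k v zero    _       = shift-injective k
residue-injective k v (suc _) zero    = doubleReflect-injective k
residue-injective k v (suc _) (suc _) = reflect-injective k

-- The labels of the paper

private
  minus-≡ : ∀ x y z → x ≡ z + y → + x ℤ.- + y ≡ + z
  minus-≡ _ y z refl = begin
    + (z + y) ℤ.- + y  ≡⟨ m-n≡m⊖n (z + y) y ⟩
    (z + y) ℤ.⊖ y      ≡⟨ ⊖-≥ (m≤n+m y z) ⟩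
    + (z + y ∸ y)      ≡⟨ cong +_ (m+n∸n≡m z y) ⟩
    + z                ∎
    where open ≡-Reasoning

  minus-plus-≡ : ∀ x y t d z → x + t * d ≡ z + y → + x ℤ.- + y ℤ.+ + t ℤ.* + d ≡ + z
  minus-plus-≡ x y t d z eq = begin
    + x ℤ.- + y ℤ.+ + t ℤ.* + d    ≡⟨ swap (+ x) (+ y) (+ t ℤ.* + d) ⟩
    (+ x ℤ.+ + t ℤ.* + d) ℤ.- + y  ≡⟨ cong (ℤ._- + y) (cong (λ p → + x ℤ.+ p) (pos-* t d)) ⟨
    (+ x ℤ.+ + (t * d)) ℤ.- + y    ≡⟨ cong (ℤ._- + y) (pos-+ x (t * d)) ⟨
    + (x + t * d) ℤ.- + y          ≡⟨ minus-≡ (x + t * d) y z eq ⟩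
    + z                            ∎
    where
    open ≡-Reasoning
    swap : ∀ X Y Z → X ℤ.- Y ℤ.+ Z ≡ (X ℤ.+ Z) ℤ.- Y
    swap = ℤ-Solver.solve-∀

  minus-minus-plus-≡ : ∀ x y y′ t d z → x + t * d ≡ z + (y + y′) →
                       + x ℤ.- + y ℤ.- + y′ ℤ.+ + t ℤ.* + d ≡ + z
  minus-minus-plus-≡ x y y′ t d z eq = begin
    + x ℤ.- + y ℤ.- + y′ ℤ.+ + t ℤ.* + d    ≡⟨ cong (ℤ._+ + t ℤ.* + d) (merge (+ x) (+ y) (+ y′)) ⟩
    + x ℤ.- (+ y ℤ.+ + y′) ℤ.+ + t ℤ.* + d  ≡⟨ cong (λ Y → + x ℤ.- Y ℤ.+ + t ℤ.* + d) (pos-+ y y′) ⟨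
    + x ℤ.- + (y + y′) ℤ.+ + t ℤ.* + d      ≡⟨ minus-plus-≡ x (y + y′) t d z eq ⟩
    + z                                     ∎
    where
    open ≡-Reasoning
    merge : ∀ X Y Z → X ℤ.- Y ℤ.- Z ≡ X ℤ.- (Y ℤ.+ Z)
    merge = ℤ-Solver.solve-∀

  onTrue : ∀ {c} {X Y Z : ℤ} → c ≡ true → X ≡ Z → (if c then X else Y) ≡ Z
  onTrue refl X≡Z = X≡Z

  onFalse : ∀ {c} {X Y Z : ℤ} → c ≡ false → Y ≡ Z → (if c then X else Y) ≡ Z
  onFalse refl Y≡Z = Y≡Z

  atResidue : ∀ {X r v m} → r ≡ v → X ≡ + suc (v + m) → X ≡ + suc (r + m)
  atResidue refl X≡ = X≡

  cong-pos : ∀ x z → x ≡ z → + x ≡ + z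
  cong-pos _ _ = cong (λ m → + m)

-- With the paper's (1-based) index suc i, each clause below checks one of the paper's
-- formulas (a side, a half, t = 1 or t > 1, a parity of j) against the rank of the spoke.
module _ {i a : ℕ} (isLow : (i <ᵇ suc (i + a)) ≡ true) where

  fU-low : ∀ b τ → b < 2 → fU (i + a) (suc i) (suc τ) (b ≡ᵇ 0)
                         ≡ + suc (residue u b τ (i + a) i + suc (offset u b + τ * 4) * W (i + a))
  fU-low 0 zero _ = onTrue isLow (atResidue (doubleReflect-low (i + a) i refl isLow)
    (minus-≡ (10 * (i + a) + 7) (2 * suc i) (suc (2 * a + 4 * suc (2 * (i + a)))) (solve (i ∷ a ∷ []))))
  fU-low 1 zero _ = onTrue isLow (atResidue (shift-low (i + a) i isLow)
    (cong-pos (5 * (i + a) + 2 + suc i) (suc (i + a + i + 2 * suc (2 * (i + a)))) (solve (i ∷ a ∷ []))))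
  fU-low 0 (suc τ) _ = onTrue isLow (atResidue (reflect-low (i + a) i refl isLow)
    (minus-plus-≡ (i + a + 2) (suc i) (suc (suc τ)) (8 * (i + a) + 4)
                  (suc (a + suc (3 + suc τ * 4) * suc (2 * (i + a)))) (solve (i ∷ a ∷ τ ∷ []))))
  fU-low 1 (suc τ) _ = onTrue isLow (atResidue (shift-low (i + a) i isLow)
    (minus-plus-≡ (suc i) (3 * (i + a) + 2) (suc (suc τ)) (8 * (i + a) + 4)
                  (suc (i + a + i + suc (1 + suc τ * 4) * suc (2 * (i + a)))) (solve (i ∷ a ∷ τ ∷ []))))
  fU-low (suc (suc _)) _ (s≤s (s≤s ()))

  fV-low : ∀ b τ → b < 2 → fV (i + a) (suc i) (suc τ) (b ≡ᵇ 0)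
                         ≡ + suc (residue v b τ (i + a) i + suc (offset v b + τ * 4) * W (i + a))
  fV-low 0 zero _ = onTrue isLow (atResidue (shift-low (i + a) i isLow)
    (cong-pos (3 * (i + a) + 1 + suc i) (suc (i + a + i + 1 * suc (2 * (i + a)))) (solve (i ∷ a ∷ []))))
  fV-low 1 zero _ = onTrue isLow (atResidue (doubleReflect-low (i + a) i refl isLow)
    (minus-≡ (8 * (i + a) + 6) (2 * suc i) (suc (2 * a + 3 * suc (2 * (i + a)))) (solve (i ∷ a ∷ []))))
  fV-low 0 (suc τ) _ = onTrue isLow (atResidue (shift-low (i + a) i isLow)
    (minus-plus-≡ (suc i) (5 * (i + a) + 3) (suc (suc τ)) (8 * (i + a) + 4)
                  (suc (i + a + i + suc (0 + suc τ * 4) * suc (2 * (i + a)))) (solve (i ∷ a ∷ τ ∷ []))))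
  fV-low 1 (suc τ) _ = onTrue isLow (atResidue (reflect-low (i + a) i refl isLow)
    (minus-minus-plus-≡ 1 (i + a) (suc i) (suc (suc τ)) (8 * (i + a) + 4)
                        (suc (a + suc (2 + suc τ * 4) * suc (2 * (i + a)))) (solve (i ∷ a ∷ τ ∷ []))))
  fV-low (suc (suc _)) _ (s≤s (s≤s ()))

module _ {e d : ℕ} (isHigh : (suc (suc e + d) + e <ᵇ suc (suc e + d)) ≡ false) where

  private
    K I : ℕ
    K = suc e + d
    I = suc K + e

  fU-high : ∀ b τ → b < 2 → fU K (suc I) (suc τ) (b ≡ᵇ 0)
                          ≡ + suc (residue u b τ K I + suc (offset u b + τ * 4) * W K)
  fU-high 0 zero _ = onFalse isHigh (atResidue (doubleReflect-high K I {e} {d} refl refl isHigh)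
    (minus-≡ (12 * (suc e + d) + 8) (2 * suc (suc (suc e + d) + e))
             (suc (suc (2 * d) + 4 * suc (2 * (suc e + d)))) (solve (e ∷ d ∷ []))))
  fU-high 1 zero _ = onFalse isHigh (atResidue (shift-high K I {e} refl isHigh)
    (cong-pos (3 * (suc e + d) + 1 + suc (suc (suc e + d) + e)) (suc (e + 2 * suc (2 * (suc e + d))))
          (solve (e ∷ d ∷ []))))
  fU-high 0 (suc τ) _ = onFalse isHigh (atResidue (reflect-high K I {e} {d} refl refl isHigh)
    (minus-plus-≡ (3 * (suc e + d) + 3) (suc (suc (suc e + d) + e)) (suc (suc τ)) (8 * (suc e + d) + 4)
                  (suc (suc (suc e + d) + d + suc (3 + suc τ * 4) * suc (2 * (suc e + d))))
                  (solve (e ∷ d ∷ τ ∷ []))))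
  fU-high 1 (suc τ) _ = onFalse isHigh (atResidue (shift-high K I {e} refl isHigh)
    (minus-plus-≡ (suc (suc (suc e + d) + e)) (5 * (suc e + d) + 3) (suc (suc τ)) (8 * (suc e + d) + 4)
                  (suc (e + suc (1 + suc τ * 4) * suc (2 * (suc e + d)))) (solve (e ∷ d ∷ τ ∷ []))))
  fU-high (suc (suc _)) _ (s≤s (s≤s ()))

  fV-high : ∀ b τ → b < 2 → fV K (suc I) (suc τ) (b ≡ᵇ 0)
                          ≡ + suc (residue v b τ K I + suc (offset v b + τ * 4) * W K)
  fV-high 0 zero _ = onFalse isHigh (atResidue (shift-high K I {e} refl isHigh)
    (cong-pos (suc e + d + suc (suc (suc e + d) + e)) (suc (e + 1 * suc (2 * (suc e + d)))) (solve (e ∷ d ∷ []))))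
  fV-high 1 zero _ = onFalse isHigh (atResidue (doubleReflect-high K I {e} {d} refl refl isHigh)
    (minus-≡ (10 * (suc e + d) + 7) (2 * suc (suc (suc e + d) + e))
             (suc (suc (2 * d) + 3 * suc (2 * (suc e + d)))) (solve (e ∷ d ∷ []))))
  fV-high 0 (suc τ) _ = onFalse isHigh (atResidue (shift-high K I {e} refl isHigh)
    (minus-plus-≡ (suc (suc (suc e + d) + e)) (7 * (suc e + d) + 4) (suc (suc τ)) (8 * (suc e + d) + 4)
                  (suc (e + suc (0 + suc τ * 4) * suc (2 * (suc e + d)))) (solve (e ∷ d ∷ τ ∷ []))))
  fV-high 1 (suc τ) _ = onFalse isHigh (atResidue (reflect-high K I {e} {d} refl refl isHigh)
    (minus-plus-≡ (suc e + d + 2) (suc (suc (suc e + d) + e)) (suc (suc τ)) (8 * (suc e + d) + 4)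
                  (suc (suc (suc e + d) + d + suc (2 + suc τ * 4) * suc (2 * (suc e + d))))
                  (solve (e ∷ d ∷ τ ∷ []))))
  fV-high (suc (suc _)) _ (s≤s (s≤s ()))

fU≡1+rank : ∀ k b τ {i} → b < 2 → i < W k →
            fU k (suc i) (suc τ) (b ≡ᵇ 0) ≡ + suc (residue u b τ k i + suc (offset u b + τ * 4) * W k)
fU≡1+rank k b τ {i} b<2 i<W with half k i i<W
... | low a refl isLow          = fU-low {i} {a} isLow b τ b<2
... | high e d refl refl isHigh = fU-high {e} {d} isHigh b τ b<2

fV≡1+rank : ∀ k b τ {i} → b < 2 → i < W k →
            fV k (suc i) (suc τ) (b ≡ᵇ 0) ≡ + suc (residue v b τ k i + suc (offset v b + τ * 4) * W k)
fV≡1+rank k b τ {i} b<2 i<W with half k i i<W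
... | low a refl isLow          = fV-low {i} {a} isLow b τ b<2
... | high e d refl refl isHigh = fV-high {e} {d} isHigh b τ b<2

-- Finite sums

sum-tabulate : ∀ m (g : Fin m → ℕ) → List.sum (tabulate g) ≡ ∑[ i < m ] g i
sum-tabulate zero    g = refl
sum-tabulate (suc m) g = cong (_+_ (g zero)) (sum-tabulate m (λ i → g (suc i)))

sum-allFin : ∀ m (g : Fin m → ℕ) → List.sum (map g (allFin m)) ≡ ∑[ i < m ] g i
sum-allFin m g = trans (cong List.sum (map-tabulate id g)) (sum-tabulate m g)

sum-concatMap : ∀ {A : Set} (f : A → List ℕ) xs →
                List.sum (concatMap f xs) ≡ List.sum (map (λ x → List.sum (f x)) xs)
sum-concatMap f []       = refl
sum-concatMap f (x ∷ xs) =
  trans (List.sum-++ (f x) (concatMap f xs)) (cong (_+_ (List.sum (f x))) (sum-concatMap f xs))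

sumℤ-filter : ∀ {A : Set} {P : A → Set} (P? : Decidable P) (h : A → ℕ) xs →
              sumℤ (map (λ x → + h x) (filter P? xs))
              ≡ + List.sum (map (λ x → if does (P? x) then h x else 0) xs)
sumℤ-filter P? h []       = refl
sumℤ-filter P? h (x ∷ xs) with does (P? x)
... | true  = trans (cong (λ z → + h x ℤ.+ z) (sumℤ-filter P? h xs)) (sym (pos-+ (h x) _))
... | false = sumℤ-filter P? h xs

sumBelow : ℕ → (ℕ → ℕ) → ℕ
sumBelow m g = ∑[ x < m ] g (toℕ x)

sumBelow-snoc : ∀ m g → sumBelow (suc m) g ≡ sumBelow m g + g m
sumBelow-snoc m g = trans (sum-init-last {m} (λ x → g (toℕ x)))
  (cong₂ _+_ (sum-cong-≗ {m} (λ x → cong g (toℕ-inject₁ x))) (cong g (toℕ-fromℕ m)))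

sumBelow-reverse : ∀ m g → sumBelow m (λ x → g (m ∸ suc x)) ≡ sumBelow m g
sumBelow-reverse zero    g = refl
sumBelow-reverse (suc m) g = begin
  g m + sumBelow m (λ x → g (m ∸ suc x))  ≡⟨ cong (_+_ (g m)) (sumBelow-reverse m g) ⟩
  g m + sumBelow m g                      ≡⟨ +-comm (g m) (sumBelow m g) ⟩
  sumBelow m g + g m                      ≡⟨ sumBelow-snoc m g ⟨
  sumBelow (suc m) g                      ∎
  where open ≡-Reasoning

sumBelow-pairs : ∀ m g → sumBelow (2 * m) g ≡ sumBelow m (λ x → g (x * 2) + g (suc (x * 2)))
sumBelow-pairs zero    g = refl
sumBelow-pairs (suc m) g = begin
  sumBelow (2 * suc m) g                 ≡⟨ cong (λ l → sumBelow l g) (2*[1+m]) ⟩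
  g 0 + (g 1 + sumBelow (2 * m) g₂)      ≡⟨ +-assoc (g 0) (g 1) _ ⟨
  g 0 + g 1 + sumBelow (2 * m) g₂        ≡⟨ cong (_+_ (g 0 + g 1)) (sumBelow-pairs m g₂) ⟩
  g 0 + g 1 + sumBelow m (λ x → g₂ (x * 2) + g₂ (suc (x * 2)))  ∎
  where
  open ≡-Reasoning
  g₂ : ℕ → ℕ
  g₂ x = g (suc (suc x))
  2*[1+m] : 2 * suc m ≡ suc (suc (2 * m))
  2*[1+m] = solve (m ∷ [])

sum-zero : ∀ {m} (g : Fin m → ℕ) → (∀ j → g j ≡ 0) → ∑[ j < m ] g j ≡ 0
sum-zero {m} g zeros = trans (sum-cong-≗ {m} zeros) (sum-replicate-zero m)

sum-single : ∀ {m} (g : Fin m → ℕ) i → (∀ j → j ≢ i → g j ≡ 0) → ∑[ j < m ] g j ≡ g i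
sum-single {suc m} g i elsewhere = begin
  ∑[ j < suc m ] g j                  ≡⟨ sum-remove {i = i} g ⟩
  g i + ∑[ j < m ] g (punchIn i j)    ≡⟨ cong (_+_ (g i)) (sum-zero (g ∘ punchIn i) (elsewhere _ ∘ punchInᵢ≢i i)) ⟩
  g i + 0                             ≡⟨ +-identityʳ (g i) ⟩
  g i                                 ∎
  where open ≡-Reasoning

private
  exchange : ∀ a b c → a + b + c ≡ c + b + a
  exchange = solve-∀

  combine : ∀ {A B X X′ a b} → A + X′ ≡ B + X → X + a ≡ X′ + b → A + a ≡ B + b
  combine {A} {B} {X} {X′} {a} {b} outer inner = +-cancelʳ-≡ (X + X′) (A + a) (B + b) (begin
    A + a + (X + X′)    ≡⟨ solve (A ∷ a ∷ X ∷ X′ ∷ []) ⟩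
    (A + X′) + (X + a)  ≡⟨ cong₂ _+_ outer inner ⟩
    (B + X) + (X′ + b)  ≡⟨ solve (B ∷ b ∷ X ∷ X′ ∷ []) ⟩
    B + b + (X + X′)    ∎)
    where open ≡-Reasoning

sum-update : ∀ {m} (f g : Fin m → ℕ) i → (∀ j → j ≢ i → f j ≡ g j) →
             ∑[ j < m ] f j + g i ≡ ∑[ j < m ] g j + f i
sum-update {suc m} f g i elsewhere = begin
  ∑[ j < suc m ] f j + g i                 ≡⟨ cong (_+ g i) (sum-remove {i = i} f) ⟩
  f i + ∑[ j < m ] f (punchIn i j) + g i   ≡⟨ cong (λ r → f i + r + g i) rest ⟩
  f i + ∑[ j < m ] g (punchIn i j) + g i   ≡⟨ exchange (f i) _ (g i) ⟩
  g i + ∑[ j < m ] g (punchIn i j) + f i   ≡⟨ cong (_+ f i) (sum-remove {i = i} g) ⟨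
  ∑[ j < suc m ] g j + f i                 ∎
  where
  open ≡-Reasoning
  rest : ∑[ j < m ] f (punchIn i j) ≡ ∑[ j < m ] g (punchIn i j)
  rest = sum-cong-≗ {m} (elsewhere _ ∘ punchInᵢ≢i i)

module _ {m m′ : ℕ} where

  private
    _≟²_ : DecidableEquality (Fin m × Fin m′)
    _≟²_ = ≡-dec _≟F_ _≟F_

  ∑∑ : (Fin m → Fin m′ → ℕ) → ℕ
  ∑∑ h = ∑[ i < m ] ∑[ j < m′ ] h i j

  ∑∑-update : ∀ (h h′ : Fin m → Fin m′ → ℕ) i j →
              (∀ i′ j′ → (i′ , j′) ≢ (i , j) → h i′ j′ ≡ h′ i′ j′) → ∑∑ h + h′ i j ≡ ∑∑ h′ + h i j
  ∑∑-update h h′ i j elsewhere =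
    combine {X = ∑[ j < m′ ] h i j} {∑[ j < m′ ] h′ i j} rows
            (sum-update (h i) (h′ i) j (λ j′ j′≢j → elsewhere i j′ (j′≢j ∘ ,-injectiveʳ)))
    where
    rows : ∑∑ h + ∑[ j < m′ ] h′ i j ≡ ∑∑ h′ + ∑[ j < m′ ] h i j
    rows = sum-update (λ i′ → ∑[ j < m′ ] h i′ j) (λ i′ → ∑[ j < m′ ] h′ i′ j) i
             (λ i′ i′≢i → sum-cong-≗ {m′} (λ j′ → elsewhere i′ j′ (i′≢i ∘ ,-injectiveˡ)))

  ∑∑-swap : ∀ (h h′ : Fin m → Fin m′ → ℕ) {i₁ j₁ i₂ j₂} → (i₁ , j₁) ≢ (i₂ , j₂) →
            (∀ i j → (i , j) ≢ (i₁ , j₁) → (i , j) ≢ (i₂ , j₂) → h i j ≡ h′ i j) →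
            h i₁ j₁ + h i₂ j₂ ≡ h′ i₁ j₁ + h′ i₂ j₂ → ∑∑ h ≡ ∑∑ h′
  ∑∑-swap h h′ {i₁} {j₁} {i₂} {j₂} c₁≢c₂ elsewhere same =
    cancel (trans (cong (_+_ (∑∑ h)) (sym mid-c₁)) (∑∑-update h mid i₁ j₁ h≡mid))
           (trans (∑∑-update mid h′ i₂ j₂ mid≡h′) (cong (_+_ (∑∑ h′)) (mid-off-c₁ i₂ j₂ (c₁≢c₂ ∘ sym))))
    where
    mid : Fin m → Fin m′ → ℕ
    mid i j = if does ((i , j) ≟² (i₁ , j₁)) then h′ i j else h i j

    mid-c₁ : mid i₁ j₁ ≡ h′ i₁ j₁
    mid-c₁ = cong (if_then h′ i₁ j₁ else h i₁ j₁) (dec-true ((i₁ , j₁) ≟² (i₁ , j₁)) refl)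

    mid-off-c₁ : ∀ i j → (i , j) ≢ (i₁ , j₁) → mid i j ≡ h i j
    mid-off-c₁ i j c≢c₁ = cong (if_then h′ i j else h i j) (dec-false ((i , j) ≟² (i₁ , j₁)) c≢c₁)

    h≡mid : ∀ i j → (i , j) ≢ (i₁ , j₁) → h i j ≡ mid i j
    h≡mid i j c≢c₁ = sym (mid-off-c₁ i j c≢c₁)

    mid≡h′ : ∀ i j → (i , j) ≢ (i₂ , j₂) → mid i j ≡ h′ i j
    mid≡h′ i j c≢c₂ with (i , j) ≟² (i₁ , j₁)
    ... | yes _    = refl
    ... | no c≢c₁  = elsewhere i j c≢c₁ c≢c₂

    cancel : ∑∑ h + h′ i₁ j₁ ≡ ∑∑ mid + h i₁ j₁ → ∑∑ mid + h′ i₂ j₂ ≡ ∑∑ h′ + h i₂ j₂ → ∑∑ h ≡ ∑∑ h′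
    cancel first second = +-cancelʳ-≡ (∑∑ mid + (h i₁ j₁ + h i₂ j₂)) (∑∑ h) (∑∑ h′) (begin
      ∑∑ h + (∑∑ mid + (h i₁ j₁ + h i₂ j₂))        ≡⟨ cong (λ s → ∑∑ h + (∑∑ mid + s)) same ⟩
      ∑∑ h + (∑∑ mid + (h′ i₁ j₁ + h′ i₂ j₂))      ≡⟨ shuffle (∑∑ h) (∑∑ mid) (h′ i₁ j₁) (h′ i₂ j₂) ⟩
      (∑∑ h + h′ i₁ j₁) + (∑∑ mid + h′ i₂ j₂)      ≡⟨ cong₂ _+_ first second ⟩
      (∑∑ mid + h i₁ j₁) + (∑∑ h′ + h i₂ j₂)       ≡⟨ shuffle′ (∑∑ mid) (h i₁ j₁) (∑∑ h′) (h i₂ j₂) ⟩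
      ∑∑ h′ + (∑∑ mid + (h i₁ j₁ + h i₂ j₂))       ∎)
      where
      open ≡-Reasoning
      shuffle : ∀ a b c d → a + (b + (c + d)) ≡ (a + c) + (b + d)
      shuffle = solve-∀
      shuffle′ : ∀ a b c d → (a + b) + (c + d) ≡ c + (a + (b + d))
      shuffle′ = solve-∀

length-cartesianProductWith : ∀ {A B C : Set} (f : A → B → C) xs ys →
                              length (cartesianProductWith f xs ys) ≡ length xs * length ys
length-cartesianProductWith f []       ys = refl
length-cartesianProductWith f (x ∷ xs) ys =
  trans (length-++ (map (f x) ys)) (cong₂ _+_ (length-map (f x) ys) (length-cartesianProductWith f xs ys))

map-cartesianProductWith : ∀ {A B C D : Set} (g : C → D) (f : A → B → C) xs ys →
                           map g (cartesianProductWith f xs ys) ≡ concatMap (λ x → map (λ y → g (f x y)) ys) xs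
map-cartesianProductWith g f []       ys = refl
map-cartesianProductWith g f (x ∷ xs) ys = begin
  map g (map (f x) ys ++ cartesianProductWith f xs ys)      ≡⟨ map-++ g (map (f x) ys) _ ⟩
  map g (map (f x) ys) ++ map g (cartesianProductWith f xs ys)
    ≡⟨ cong₂ _++_ (sym (map-∘ ys)) (map-cartesianProductWith g f xs ys) ⟩
  map (λ y → g (f x y)) ys ++ concatMap (λ x → map (λ y → g (f x y)) ys) xs  ∎
  where open ≡-Reasoning

module _ {A : Set} (_≟_ : DecidableEquality A) where

  open ListAll using ([]; _∷_)
  open AllPairs using ([]; _∷_)

  open import Data.List.Membership.DecPropositional _≟_ using (_∈?_)
  open import Data.List.Relation.Unary.Unique.DecPropositional.Properties _≟_ using (deduplicate-!)

  unique-⊆⇒length≤ : ∀ {xs ys : List A} → Unique xs → Unique ys → xs ⊆ ys → length xs ≤ length ys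
  unique-⊆⇒length≤ {xs} {ys} xs! ys! xs⊆ys = begin
    length xs                     ≡⟨ ↭-length (∼bag⇒↭ (unique∧set⇒bag xs! (filter⁺ (_∈? xs) ys!) same)) ⟩
    length (filter (_∈? xs) ys)   ≤⟨ length-filter (_∈? xs) ys ⟩
    length ys                     ∎
    where
    open ≤-Reasoning
    same : ∀ {z} → z ∈ xs ⇔ z ∈ filter (_∈? xs) ys
    same = mk⇔ (λ z∈xs → ∈-filter⁺ (_∈? xs) (xs⊆ys z∈xs) z∈xs)
               (λ z∈f → proj₂ (∈-filter⁻ (_∈? xs) {xs = ys} z∈f))

  module _ {a b c : A} (a≢b : a ≢ b) (a≢c : a ≢ c) (b≢c : b ≢ c) where

    private
      abc! : Unique (a ∷ b ∷ c ∷ [])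
      abc! = (a≢b ∷ a≢c ∷ []) ∷ (b≢c ∷ []) ∷ [] ∷ []

    3≤length-deduplicate : ∀ {xs} → a ∈ xs → b ∈ xs → c ∈ xs → 3 ≤ length (deduplicate _≟_ xs)
    3≤length-deduplicate {xs} a∈xs b∈xs c∈xs = unique-⊆⇒length≤ abc! (deduplicate-! xs) abc⊆
      where
      abc⊆ : a ∷ b ∷ c ∷ [] ⊆ deduplicate _≟_ xs
      abc⊆ (here refl)                = ∈-deduplicate⁺ _≟_ a∈xs
      abc⊆ (there (here refl))        = ∈-deduplicate⁺ _≟_ b∈xs
      abc⊆ (there (there (here refl))) = ∈-deduplicate⁺ _≟_ c∈xs

    length-deduplicate≡3 : ∀ {xs} → a ∈ xs → b ∈ xs → c ∈ xs → xs ⊆ a ∷ b ∷ c ∷ [] →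
                           length (deduplicate _≟_ xs) ≡ 3
    length-deduplicate≡3 {xs} a∈xs b∈xs c∈xs xs⊆abc = ≤-antisym
      (unique-⊆⇒length≤ (deduplicate-! xs) abc! (xs⊆abc ∘ ∈-deduplicate⁻ _≟_ xs))
      (3≤length-deduplicate a∈xs b∈xs c∈xs)

injective⇒surjective : ∀ {m} (f : Fin m → Fin m) → (∀ {x y} → f x ≡ f y → x ≡ y) → ∀ y → ∃ λ x → f x ≡ y
injective⇒surjective {suc m} f f-inj y with any? (λ x → f x ≟F y)
... | yes hit = hit
... | no miss = ⊥-elim (<-irrefl refl (injective⇒≤ {f = g} g-inj))
  where
  f≢y : ∀ x → y ≢ f x
  f≢y x y≡fx = miss (x , sym y≡fx)
  g : Fin (suc m) → Fin m
  g x = punchOut (f≢y x)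
  g-inj : ∀ {x x′} → g x ≡ g x′ → x ≡ x′
  g-inj {x} {x′} eq = f-inj (punchOut-injective (f≢y x) (f≢y x′) eq)

module NamedEdges {V A : Set} (_≟V_ : DecidableEquality V) (vertices : List V)
                  (ends : A → V × V) (names : List A) where

  open ListAll using ([]; _∷_)
  open AllPairs using ([]; _∷_)

  graph : Graph
  graph = record { Vertex = V ; _≟V_ = _≟V_ ; vertices = vertices ; edges = map ends names }

  nameAt : (as : List A) → Fin (length (map ends as)) → A
  nameAt (a ∷ _)  zero    = a
  nameAt (_ ∷ as) (suc e) = nameAt as e

  lookup-nameAt : ∀ as e → lookup (map ends as) e ≡ ends (nameAt as e)
  lookup-nameAt (_ ∷ _)  zero    = refl
  lookup-nameAt (_ ∷ as) (suc e) = lookup-nameAt as e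

  nameAt-avoids : ∀ {a as} → All (a ≢_) as → ∀ e → a ≢ nameAt as e
  nameAt-avoids (a≢b ∷ _)  zero    = a≢b
  nameAt-avoids (_ ∷ a∉as) (suc e) = nameAt-avoids a∉as e

  nameAt-injective : ∀ {as} → Unique as → ∀ {e e′} → nameAt as e ≡ nameAt as e′ → e ≡ e′
  nameAt-injective {_ ∷ _}  _          {zero}  {zero}   _  = refl
  nameAt-injective {_ ∷ _}  (a∉as ∷ _) {zero}  {suc e′} eq = ⊥-elim (nameAt-avoids a∉as e′ eq)
  nameAt-injective {_ ∷ _}  (a∉as ∷ _) {suc e} {zero}   eq = ⊥-elim (nameAt-avoids a∉as e (sym eq))
  nameAt-injective {_ ∷ _}  (_ ∷ as!)  {suc e} {suc e′} eq = cong suc (nameAt-injective as! eq)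

  sum-nameAt : ∀ as (g : A → ℕ) → ∑[ e < length (map ends as) ] g (nameAt as e) ≡ List.sum (map g as)
  sum-nameAt []       g = refl
  sum-nameAt (a ∷ as) g = cong (_+_ (g a)) (sum-nameAt as g)

  touches : V → V × V → Bool
  touches w p = does (w ≟V proj₁ p) ∨ does (w ≟V proj₂ p)

  touches-fst : ∀ {w x y} → x ≡ w → touches w (x , y) ≡ true
  touches-fst {w} {y = y} refl = cong (_∨ does (w ≟V y)) (dec-true (w ≟V w) refl)

  touches-snd : ∀ {w x y} → y ≡ w → touches w (x , y) ≡ true
  touches-snd {w} {x} refl = trans (cong (does (w ≟V x) ∨_) (dec-true (w ≟V w) refl)) (∨-zeroʳ _)

  touches-neither : ∀ {w x y} → w ≢ x → w ≢ y → touches w (x , y) ≡ false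
  touches-neither {w} {x} {y} w≢x w≢y = cong₂ _∨_ (dec-false (w ≟V x) w≢x) (dec-false (w ≟V y) w≢y)

  module Ranked (names! : Unique names) (rank : A → ℕ) (rank-injective : ∀ {a a′} → rank a ≡ rank a′ → a ≡ a′)
                (rank< : ∀ a → rank a < length names) where

    private
      q : ℕ
      q = length (map ends names)

      rank<q : ∀ e → rank (nameAt names e) < q
      rank<q e = subst (rank (nameAt names e) <_) (sym (length-map ends names)) (rank< (nameAt names e))

      toLabel : Fin q → Fin q
      toLabel e = fromℕ< (rank<q e)

      toLabel-injective : ∀ {e e′} → toLabel e ≡ toLabel e′ → e ≡ e′
      toLabel-injective {e} {e′} eq = nameAt-injective names! (rank-injective (begin
        rank (nameAt names e)   ≡⟨ toℕ-fromℕ< (rank<q e) ⟨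
        toℕ (toLabel e)         ≡⟨ cong toℕ eq ⟩
        toℕ (toLabel e′)        ≡⟨ toℕ-fromℕ< (rank<q e′) ⟩
        rank (nameAt names e′)  ∎))
        where open ≡-Reasoning

    incidentLabel : V → A → ℕ
    incidentLabel w a = if touches w (ends a) then suc (rank a) else 0

    incidentLabel-fst : ∀ w a → proj₁ (ends a) ≡ w → incidentLabel w a ≡ suc (rank a)
    incidentLabel-fst w a eq = cong (if_then suc (rank a) else 0) (touches-fst eq)

    incidentLabel-snd : ∀ w a → proj₂ (ends a) ≡ w → incidentLabel w a ≡ suc (rank a)
    incidentLabel-snd w a eq = cong (if_then suc (rank a) else 0) (touches-snd eq)

    incidentLabel-off : ∀ w a → w ≢ proj₁ (ends a) → w ≢ proj₂ (ends a) → incidentLabel w a ≡ 0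
    incidentLabel-off w a w≢x w≢y = cong (if_then suc (rank a) else 0) (touches-neither w≢x w≢y)

    rankLabeling : Labeling graph
    rankLabeling = mk⤖ (toLabel-injective , λ l → let (e , e↦l) = injective⇒surjective toLabel toLabel-injective l
                                                   in e , λ { refl → e↦l })

    vsum-rankLabeling : ∀ w → vsum graph rankLabeling w ≡ List.sum (map (incidentLabel w) names)
    vsum-rankLabeling w = begin
      List.sum (map contribution (allFin q))      ≡⟨ sum-allFin q contribution ⟩
      ∑[ e < q ] contribution e                   ≡⟨ sum-cong-≗ {q} byName ⟩
      ∑[ e < q ] incidentLabel w (nameAt names e) ≡⟨ sum-nameAt names (incidentLabel w) ⟩
      List.sum (map (incidentLabel w) names)      ∎
      where
      open ≡-Reasoning
      contribution : Fin q → ℕ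
      contribution e = if incident graph w e then label graph rankLabeling e else 0
      byName : ∀ e → contribution e ≡ incidentLabel w (nameAt names e)
      byName e rewrite lookup-nameAt names e | toℕ-fromℕ< (rank<q e) = refl

    antimagic-by-values : (val : V → ℕ) → (∀ w → vsum graph rankLabeling w ≡ val w) →
                          (∀ a → val (proj₁ (ends a)) ≢ val (proj₂ (ends a))) → IsLocalAntimagic graph rankLabeling
    antimagic-by-values val vsum≡val separated e eq =
      separated (nameAt names e) (subst (λ p → val (proj₁ p) ≡ val (proj₂ p)) (lookup-nameAt names e)
        (trans (sym (vsum≡val _)) (trans eq (vsum≡val _))))

module _ (G : Graph) (f : Labeling G) where
  open Graph G using (vertices)

  numValues≡3 : ∀ {x y z} → x ∈ vertices → y ∈ vertices → z ∈ vertices →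
                vsum G f x ≢ vsum G f y → vsum G f x ≢ vsum G f z → vsum G f y ≢ vsum G f z →
                (∀ w → vsum G f w ∈ map (vsum G f) (x ∷ y ∷ z ∷ [])) → numValues G f ≡ 3
  numValues≡3 {x} {y} {z} x∈ y∈ z∈ x≢y x≢z y≢z range =
    length-deduplicate≡3 ℕ._≟_ x≢y x≢z y≢z (∈-map⁺ (vsum G f) x∈) (∈-map⁺ (vsum G f) y∈) (∈-map⁺ (vsum G f) z∈)
                         inRange
    where
    inRange : map (vsum G f) vertices ⊆ map (vsum G f) (x ∷ y ∷ z ∷ [])
    inRange t∈ with w , _ , refl ← ∈-map⁻ (vsum G f) t∈ = range w

  triangle⇒3≤numValues : ∀ {x y z} (e₁ e₂ e₃ : Edge G) →
                         endpoints G e₁ ≡ (x , y) → endpoints G e₂ ≡ (x , z) → endpoints G e₃ ≡ (y , z) →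
                         x ∈ vertices → y ∈ vertices → z ∈ vertices →
                         IsLocalAntimagic G f → 3 ≤ numValues G f
  triangle⇒3≤numValues e₁ e₂ e₃ e₁≡ e₂≡ e₃≡ x∈ y∈ z∈ antimagic =
    3≤length-deduplicate ℕ._≟_ (apart e₁ e₁≡) (apart e₂ e₂≡) (apart e₃ e₃≡)
                         (∈-map⁺ (vsum G f) x∈) (∈-map⁺ (vsum G f) y∈) (∈-map⁺ (vsum G f) z∈)
    where
    apart : ∀ {a b} e → endpoints G e ≡ (a , b) → vsum G f a ≢ vsum G f b
    apart e refl = antimagic e

-- The labelling of Γ

module Labels (k n : ℕ) where

  data EdgeKind : Set where
    uv    : EdgeKind
    spoke : Side → JIdx n → EdgeKind

  EdgeName : Set
  EdgeName = Idx k × EdgeKind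

  parity : JIdx n → ℕ
  parity j = toℕ j % 2

  -- The spokes s_i x_{i,2m+1}, s_i x_{i,2m+2} (1-based) carry the parameter
  -- t = depth s m + 1 of the paper's formulas.
  depth : Side → ℕ → ℕ
  depth u m = n ∸ suc m
  depth v m = m

  level : Side → JIdx n → ℕ
  level s j = depth s (toℕ j / 2)

  spokeBlock : Side → JIdx n → ℕ
  spokeBlock s j = suc (offset s (parity j) + level s j * 4)

  position : EdgeName → ℕ
  position (i , uv)        = toℕ i
  position (i , spoke s j) = residue s (parity j) (level s j) k (toℕ i)

  blockOf : EdgeName → ℕ
  blockOf (i , uv)        = 0
  blockOf (i , spoke s j) = spokeBlock s j

  -- The label minus one.  The rungs take 0 … 2k; the four spokes at i with t = τ + 1
  -- lie in the blocks 4τ + 1, …, 4τ + 4 of 2k + 1 consecutive numbers, the position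
  -- inside a block being one of the three permutations applied to i.
  rank : EdgeName → ℕ
  rank a = position a + blockOf a * W k

  parity<2 : (j : JIdx n) → parity j < 2
  parity<2 j = m%n<n (toℕ j) 2

  toℕ≡parity+half*2 : (j : JIdx n) → toℕ j ≡ parity j + toℕ j / 2 * 2
  toℕ≡parity+half*2 j = m≡m%n+[m/n]*n (toℕ j) 2

  half<n : (j : JIdx n) → toℕ j / 2 < n
  half<n j = *-cancelʳ-< 2 (toℕ j / 2) n (begin-strict
    toℕ j / 2 * 2              ≤⟨ m≤n+m (toℕ j / 2 * 2) (parity j) ⟩
    parity j + toℕ j / 2 * 2   ≡⟨ toℕ≡parity+half*2 j ⟨
    toℕ j                      <⟨ toℕ<n j ⟩
    2 * n                      ≡⟨ *-comm 2 n ⟩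
    n * 2                      ∎)
    where open ≤-Reasoning

  JIdx-injective : {j j′ : JIdx n} → parity j ≡ parity j′ → toℕ j / 2 ≡ toℕ j′ / 2 → j ≡ j′
  JIdx-injective {j} {j′} b≡b′ m≡m′ = toℕ-injective (begin
    toℕ j                       ≡⟨ toℕ≡parity+half*2 j ⟩
    parity j + toℕ j / 2 * 2    ≡⟨ cong₂ (λ b m → b + m * 2) b≡b′ m≡m′ ⟩
    parity j′ + toℕ j′ / 2 * 2  ≡⟨ toℕ≡parity+half*2 j′ ⟨
    toℕ j′                      ∎)
    where open ≡-Reasoning

  depth<n : ∀ s {m} → m < n → depth s m < n
  depth<n u m<n = ∸-monoʳ-< z<s m<n
  depth<n v m<n = m<n

  depth-injective : ∀ s {m m′} → m < n → m′ < n → depth s m ≡ depth s m′ → m ≡ m′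
  depth-injective u m<n m′<n eq = suc-injective (∸-cancelˡ-≡ m<n m′<n eq)
  depth-injective v _ _ eq = eq

  level<n : ∀ s (j : JIdx n) → level s j < n
  level<n s j = depth<n s (half<n j)

  position<W : ∀ a → position a < W k
  position<W (i , uv)        = toℕ<n i
  position<W (i , spoke s j) = residue<W k s (parity j) (level s j) (toℕ<n i)

  spokeBlock≤ : ∀ s j → spokeBlock s j ≤ 2 * n * 2
  spokeBlock≤ s j = begin
    suc (offset s (parity j) + level s j * 4)  ≤⟨ s≤s (+-monoˡ-≤ (level s j * 4) (offset≤3 s (parity j))) ⟩
    suc (3 + level s j * 4)                    ≤⟨ *-monoˡ-≤ 4 (level<n s j) ⟩
    n * 4                                      ≡⟨ solve (n ∷ []) ⟩
    2 * n * 2                                  ∎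
    where open ≤-Reasoning

  rank< : ∀ a → rank a < W k * suc (2 * n * 2)
  rank< a = begin-strict
    position a + blockOf a * W k  <⟨ +-monoˡ-< (blockOf a * W k) (position<W a) ⟩
    suc (blockOf a) * W k       ≤⟨ *-monoˡ-≤ (W k) (s≤s (blockOf≤ a)) ⟩
    suc (2 * n * 2) * W k   ≡⟨ *-comm (suc (2 * n * 2)) (W k) ⟩
    W k * suc (2 * n * 2)   ∎
    where
    open ≤-Reasoning
    blockOf≤ : ∀ a → blockOf a ≤ 2 * n * 2
    blockOf≤ (i , uv)        = z≤n
    blockOf≤ (i , spoke s j) = spokeBlock≤ s j

  spokeBlock-injective : ∀ {s s′ j j′} → spokeBlock s j ≡ spokeBlock s′ j′ → s ≡ s′ × j ≡ j′
  spokeBlock-injective {s} {s′} {j} {j′} eq =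
    sides (offset-injective (parity<2 j) (parity<2 j′) (proj₁ split)) (proj₂ split)
    where
    split : offset s (parity j) ≡ offset s′ (parity j′) × level s j ≡ level s′ j′
    split = divMod-unique (s≤s (offset≤3 s (parity j))) (s≤s (offset≤3 s′ (parity j′))) (suc-injective eq)
    sides : ∀ {s s′} → s ≡ s′ × parity j ≡ parity j′ → level s j ≡ level s′ j′ → s ≡ s′ × j ≡ j′
    sides {s} (refl , b≡b′) l≡l′ = refl , JIdx-injective b≡b′ (depth-injective s (half<n j) (half<n j′) l≡l′)

  rank-injective : ∀ {a a′} → rank a ≡ rank a′ → a ≡ a′
  rank-injective {a} {a′} eq = fromDigits a a′ (divMod-unique (position<W a) (position<W a′) eq)
    where
    fromDigits : ∀ a a′ → position a ≡ position a′ × blockOf a ≡ blockOf a′ → a ≡ a′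
    fromDigits (i , uv)        (i′ , uv)          (c≡c′ , _)    = cong (_, uv) (toℕ-injective c≡c′)
    fromDigits (i , spoke s j) (i′ , spoke s′ j′) (c≡c′ , r≡r′) with spokeBlock-injective {s} {s′} {j} {j′} r≡r′
    ... | refl , refl =
      cong (_, spoke s j) (toℕ-injective (residue-injective k s (parity j) (level s j) (toℕ<n i) (toℕ<n i′) c≡c′))

  labU≡1+rank : ∀ i j → labU k n i j ≡ + suc (rank (i , spoke u j))
  labU≡1+rank i j = trans (cong (λ t → fU k (suc (toℕ i)) t (parity j ≡ᵇ 0)) (∸≡suc∸suc (half<n j)))
                          (fU≡1+rank k (parity j) (level u j) (parity<2 j) (toℕ<n i))

  labV≡1+rank : ∀ i j → labV k n i j ≡ + suc (rank (i , spoke v j))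
  labV≡1+rank i j = fV≡1+rank k (parity j) (level v j) (parity<2 j) (toℕ<n i)

  spokeSum : Idx k → JIdx n → ℕ
  spokeSum i j = suc (rank (i , spoke u j)) + suc (rank (i , spoke v j))

  σ≡spokeSum : ∀ j i → σ k n j i ≡ + spokeSum i j
  σ≡spokeSum j i = trans (cong₂ ℤ._+_ (labU≡1+rank i j) (labV≡1+rank i j))
                         (sym (pos-+ (suc (rank (i , spoke u j))) (suc (rank (i , spoke v j)))))

  spokeLabel : Side → ℕ → ℕ → ℕ → ℕ
  spokeLabel s i b τ = suc (residue s b τ k i + suc (offset s b + τ * 4) * W k)

  pairAt : Side → ℕ → ℕ → ℕ
  pairAt s i τ = spokeLabel s i 0 τ + spokeLabel s i 1 τ

  sumBelow-depth : ∀ s g → sumBelow n (λ m → g (depth s m)) ≡ sumBelow n g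
  sumBelow-depth u g = sumBelow-reverse n g
  sumBelow-depth v g = refl

  spokes≡pairs : ∀ s (i : Idx k) → ∑[ j < 2 * n ] suc (rank (i , spoke s j)) ≡ sumBelow n (pairAt s (toℕ i))
  spokes≡pairs s i = begin
    sumBelow (2 * n) (λ m → spokeLabel s (toℕ i) (m % 2) (depth s (m / 2)))
      ≡⟨ sumBelow-pairs n (λ m → spokeLabel s (toℕ i) (m % 2) (depth s (m / 2))) ⟩
    sumBelow n (λ x → spokeLabel s (toℕ i) (x * 2 % 2) (depth s (x * 2 / 2))
                    + spokeLabel s (toℕ i) (suc (x * 2) % 2) (depth s (suc (x * 2) / 2)))
      ≡⟨ sum-cong-≗ {n} (λ x → cong₂ _+_ (atHalf {0} (toℕ x) z<s) (atHalf {1} (toℕ x) (s<s z<s))) ⟩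
    sumBelow n (λ m → pairAt s (toℕ i) (depth s m))
      ≡⟨ sumBelow-depth s (pairAt s (toℕ i)) ⟩
    sumBelow n (pairAt s (toℕ i))  ∎
    where
    open ≡-Reasoning
    atHalf : ∀ {r} x → r < 2 → spokeLabel s (toℕ i) ((r + x * 2) % 2) (depth s ((r + x * 2) / 2))
                              ≡ spokeLabel s (toℕ i) r (depth s x)
    atHalf x r<2 = cong₂ (λ b m → spokeLabel s (toℕ i) b (depth s m)) (proj₁ (halving x r<2)) (proj₂ (halving x r<2))

  pairTotal : Side → ℕ → ℕ
  pairTotal u τ = 2 + 2 * k + (6 + τ * 8) * W k
  pairTotal v τ = 2 + 2 * k + (4 + τ * 8) * W k

  rowTotal : Side → ℕ → ℕ
  rowTotal u m = (8 * k + 4) * m * m + (6 * k + 4) * m + k + 1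
  rowTotal v m = (8 * k + 4) * m * m + (2 * k + 2) * m + k + 1

  pairAt-suc : ∀ s {i} → i < W k → ∀ τ → pairAt s i (suc τ) ≡ pairTotal s (suc τ)
  pairAt-suc u {i} i<W τ = begin
    suc (reflect k i + suc (3 + suc τ * 4) * W k) + suc (shift k i + suc (1 + suc τ * 4) * W k)
      ≡⟨ regroup (reflect k i) (shift k i) τ (W k) ⟩
    2 + (shift k i + reflect k i) + (6 + suc τ * 8) * W k
      ≡⟨ cong (λ z → 2 + z + (6 + suc τ * 8) * W k) (shift+reflect k i i<W) ⟩
    pairTotal u (suc τ)  ∎
    where
    open ≡-Reasoning
    regroup : ∀ x y t w → suc (x + suc (3 + suc t * 4) * w) + suc (y + suc (1 + suc t * 4) * w)
                        ≡ 2 + (y + x) + (6 + suc t * 8) * w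
    regroup = solve-∀
  pairAt-suc v {i} i<W τ = begin
    suc (shift k i + suc (0 + suc τ * 4) * W k) + suc (reflect k i + suc (2 + suc τ * 4) * W k)
      ≡⟨ regroup (shift k i) (reflect k i) τ (W k) ⟩
    2 + (shift k i + reflect k i) + (4 + suc τ * 8) * W k
      ≡⟨ cong (λ z → 2 + z + (4 + suc τ * 8) * W k) (shift+reflect k i i<W) ⟩
    pairTotal v (suc τ)  ∎
    where
    open ≡-Reasoning
    regroup : ∀ x y t w → suc (x + suc (0 + suc t * 4) * w) + suc (y + suc (2 + suc t * 4) * w)
                        ≡ 2 + (x + y) + (4 + suc t * 8) * w
    regroup = solve-∀

  rung+pairAt-zero : ∀ s {i} → i < W k → suc i + pairAt s i 0 ≡ suc k + pairTotal s 0
  rung+pairAt-zero u {i} i<W = begin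
    suc i + (suc (doubleReflect k i + 4 * W k) + suc (shift k i + 2 * W k))
      ≡⟨ regroup (doubleReflect k i) (shift k i) i (W k) ⟩
    3 + (doubleReflect k i + shift k i + i) + 6 * W k
      ≡⟨ cong (λ z → 3 + z + 6 * W k) (doubleReflect+shift+i k i i<W) ⟩
    3 + 3 * k + 6 * suc (2 * k)
      ≡⟨ solve (k ∷ []) ⟩
    suc k + (2 + 2 * k + (6 + 0 * 8) * suc (2 * k))
      ≡⟨⟩
    suc k + pairTotal u 0  ∎
    where
    open ≡-Reasoning
    regroup : ∀ x y z w → suc z + (suc (x + 4 * w) + suc (y + 2 * w)) ≡ 3 + (x + y + z) + 6 * w
    regroup = solve-∀
  rung+pairAt-zero v {i} i<W = begin
    suc i + (suc (shift k i + 1 * W k) + suc (doubleReflect k i + 3 * W k))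
      ≡⟨ regroup (doubleReflect k i) (shift k i) i (W k) ⟩
    3 + (doubleReflect k i + shift k i + i) + 4 * W k
      ≡⟨ cong (λ z → 3 + z + 4 * W k) (doubleReflect+shift+i k i i<W) ⟩
    3 + 3 * k + 4 * suc (2 * k)
      ≡⟨ solve (k ∷ []) ⟩
    suc k + (2 + 2 * k + (4 + 0 * 8) * suc (2 * k))
      ≡⟨⟩
    suc k + pairTotal v 0  ∎
    where
    open ≡-Reasoning
    regroup : ∀ x y z w → suc z + (suc (y + 1 * w) + suc (x + 3 * w)) ≡ 3 + (x + y + z) + 4 * w
    regroup = solve-∀

  rowTotal-step : ∀ s m → rowTotal s m + pairTotal s m ≡ rowTotal s (suc m)
  rowTotal-step u m = step k m
    where
    step : ∀ k m → (8 * k + 4) * m * m + (6 * k + 4) * m + k + 1 + (2 + 2 * k + (6 + m * 8) * suc (2 * k))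
                 ≡ (8 * k + 4) * suc m * suc m + (6 * k + 4) * suc m + k + 1
    step = solve-∀
  rowTotal-step v m = step k m
    where
    step : ∀ k m → (8 * k + 4) * m * m + (2 * k + 2) * m + k + 1 + (2 + 2 * k + (4 + m * 8) * suc (2 * k))
                 ≡ (8 * k + 4) * suc m * suc m + (2 * k + 2) * suc m + k + 1
    step = solve-∀

  rowTotal-sum : ∀ s m → suc k + sumBelow m (pairTotal s) ≡ rowTotal s m
  rowTotal-sum u zero = start k
    where
    start : ∀ k → suc k + 0 ≡ (8 * k + 4) * 0 * 0 + (6 * k + 4) * 0 + k + 1
    start = solve-∀
  rowTotal-sum v zero = start k
    where
    start : ∀ k → suc k + 0 ≡ (8 * k + 4) * 0 * 0 + (2 * k + 2) * 0 + k + 1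
    start = solve-∀
  rowTotal-sum s (suc m) = begin
    suc k + sumBelow (suc m) (pairTotal s)              ≡⟨ cong (λ z → suc k + z) (sumBelow-snoc m (pairTotal s)) ⟩
    suc k + (sumBelow m (pairTotal s) + pairTotal s m)  ≡⟨ +-assoc (suc k) _ _ ⟨
    suc k + sumBelow m (pairTotal s) + pairTotal s m    ≡⟨ cong (_+ pairTotal s m) (rowTotal-sum s m) ⟩
    rowTotal s m + pairTotal s m                        ≡⟨ rowTotal-step s m ⟩
    rowTotal s (suc m)                                  ∎
    where open ≡-Reasoning

  rung+spokes : 1 ≤ n → ∀ s (i : Idx k) → suc (toℕ i) + ∑[ j < 2 * n ] suc (rank (i , spoke s j)) ≡ rowTotal s n
  rung+spokes (s≤s {n = n′} z≤n) s i = begin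
    suc (toℕ i) + ∑[ j < 2 * n ] suc (rank (i , spoke s j))
      ≡⟨ cong (λ z → suc (toℕ i) + z) (spokes≡pairs s i) ⟩
    suc (toℕ i) + (pairAt s (toℕ i) 0 + sumBelow n′ (λ τ → pairAt s (toℕ i) (suc τ)))
      ≡⟨ +-assoc (suc (toℕ i)) _ _ ⟨
    suc (toℕ i) + pairAt s (toℕ i) 0 + sumBelow n′ (λ τ → pairAt s (toℕ i) (suc τ))
      ≡⟨ cong₂ _+_ (rung+pairAt-zero s (toℕ<n i)) (sum-cong-≗ {n′} (λ τ → pairAt-suc s (toℕ<n i) (toℕ τ))) ⟩
    suc k + pairTotal s 0 + sumBelow n′ (λ τ → pairTotal s (suc τ))
      ≡⟨ +-assoc (suc k) _ _ ⟩
    suc k + sumBelow n (pairTotal s)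
      ≡⟨ rowTotal-sum s n ⟩
    rowTotal s n  ∎
    where open ≡-Reasoning

  target : ℕ
  target = 4 * k + 3 + n * (8 * k + 4)

  rowTotal-u≢multiple : ∀ d → rowTotal u n ≢ d * target
  rowTotal-u≢multiple = between-multiples⇒≢multiple {c = n} (above k n) (split k n)
    where
    above : ∀ k n → (8 * k + 4) * n * n + (6 * k + 4) * n + k + 1
                  ≡ n * (4 * k + 3 + n * (8 * k + 4)) + suc ((2 * k + 1) * n + k)
    above = solve-∀
    split : ∀ k n → 4 * k + 3 + n * (8 * k + 4) ≡ suc ((2 * k + 1) * n + k) + suc ((6 * k + 3) * n + 3 * k + 1)
    split = solve-∀

  rowTotal-v≢multiple : 2 ≤ n → ∀ d → rowTotal v n ≢ d * target
  rowTotal-v≢multiple (s≤s (s≤s {n = m} z≤n)) = between-multiples⇒≢multiple {c = suc m} (above k m) (split k m)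
    where
    above : ∀ k m → (8 * k + 4) * (2 + m) * (2 + m) + (2 * k + 2) * (2 + m) + k + 1
                  ≡ suc m * (4 * k + 3 + (2 + m) * (8 * k + 4)) + suc ((6 * k + 3) * (2 + m) + 5 * k + 3)
    above = solve-∀
    split : ∀ k m → 4 * k + 3 + (2 + m) * (8 * k + 4)
                  ≡ suc ((6 * k + 3) * (2 + m) + 5 * k + 3) + suc ((2 * k + 1) * m + 3 * k)
    split = solve-∀

  rowTotal-u≢v : 1 ≤ n → rowTotal u n ≢ rowTotal v n
  rowTotal-u≢v (s≤s {n = m} z≤n) eq = m+1+n≢m (rowTotal v n) (trans (apart k m) eq)
    where
    apart : ∀ k m → (8 * k + 4) * suc m * suc m + (2 * k + 2) * suc m + k + 1 + suc ((4 * k + 2) * m + 4 * k + 1)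
                  ≡ (8 * k + 4) * suc m * suc m + (6 * k + 4) * suc m + k + 1
    apart = solve-∀

-- The graphs of ℋ

closure-preserves : ∀ {A : Set} {R : A → A → Set} (P : A → Set) → (∀ {x y} → R x y → P x → P y) →
                    ∀ {x y} → TransClosure R x y → P x → P y
closure-preserves P step [ xRy ]        = step xRy
closure-preserves P step (xRy ∷⁺ yR⁺z) = closure-preserves P step yR⁺z ∘′ step xRy

module Merged (k n r s : ℕ) where

  open Labels k n

  weightAt : Config k n r → MVert n r → Idx k → JIdx n → ℕ
  weightAt X x i j = if does (decM n r (X i j) x) then spokeSum i j else 0

  mergedSum : Config k n r → MVert n r → ℕ
  mergedSum X x = ∑∑ (weightAt X x)

  Balanced : Config k n r → Set
  Balanced X = ∀ x → mergedSum X x ≡ suc (2 * s) * target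

  balanced-init : ∀ π → ValidPartition k n r s π → Balanced (initConfig k n r π)
  balanced-init π valid (j′ , b) = pos-injective (begin
    + mergedSum (initConfig k n r π) (j′ , b)
      ≡⟨ cong +_ (sum-cong-≗ {W k} row-sum) ⟩
    + ∑[ i < W k ] member i
      ≡⟨ cong +_ (sum-allFin (W k) member) ⟨
    + List.sum (map member (allFin (W k)))
      ≡⟨ sumℤ-filter (λ i → π j′ i ≟F b) (λ i → spokeSum i j′) (allFin (W k)) ⟨
    sumℤ (map (λ i → + spokeSum i j′) (block k n r π j′ b))
      ≡⟨ cong sumℤ (map-cong (λ i → sym (σ≡spokeSum j′ i)) (block k n r π j′ b)) ⟩
    sumℤ (map (σ k n j′) (block k n r π j′ b))
      ≡⟨ proj₂ (valid j′ b) ⟩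
    + suc (2 * s) ℤ.* Tgt k n
      ≡⟨ pos-* (suc (2 * s)) target ⟨
    + (suc (2 * s) * target)  ∎)
    where
    open ≡-Reasoning
    member : Idx k → ℕ
    member i = if does (π j′ i ≟F b) then spokeSum i j′ else 0

    row-sum : ∀ i → ∑[ j < 2 * n ] weightAt (initConfig k n r π) (j′ , b) i j ≡ member i
    row-sum i = trans (sum-single (weightAt (initConfig k n r π) (j′ , b) i) j′ other) at-j′
      where
      other : ∀ j → j ≢ j′ → weightAt (initConfig k n r π) (j′ , b) i j ≡ 0
      other j j≢j′ =
        cong (if_then spokeSum i j else 0) (dec-false (decM n r (j , π j i) (j′ , b)) (j≢j′ ∘ ,-injectiveˡ))
      at-j′ : weightAt (initConfig k n r π) (j′ , b) i j′ ≡ member i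
      at-j′ with π j′ i ≟F b
      ... | yes πi≡b =
        cong (if_then spokeSum i j′ else 0) (dec-true (decM n r (j′ , π j′ i) (j′ , b)) (cong (j′ ,_) πi≡b))
      ... | no  πi≢b =
        cong (if_then spokeSum i j′ else 0) (dec-false (decM n r (j′ , π j′ i) (j′ , b)) (πi≢b ∘ ,-injectiveʳ))

  private
    both-match : ∀ {a i : Idx k} {b j : JIdx n} → (a , b) ≡ (i , j) → does (a ≟F i) ∧ does (b ≟F j) ≡ true
    both-match {a} {b = b} refl rewrite dec-true (a ≟F a) refl | dec-true (b ≟F b) refl = refl

    not-both-match : ∀ {a i : Idx k} {b j : JIdx n} → (a , b) ≢ (i , j) → does (a ≟F i) ∧ does (b ≟F j) ≡ false
    not-both-match {a} {i} {b} {j} ab≢ij with a ≟F i | b ≟F j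
    ... | yes refl | yes refl = ⊥-elim (ab≢ij refl)
    ... | yes _    | no _     = refl
    ... | no _     | _        = refl

  module _ (X : Config k n r) (i : Idx k) (j : JIdx n) (i′ : Idx k) (j′ : JIdx n) where

    swapSlots-first : swapSlots k n r X i j i′ j′ i j ≡ X i′ j′
    swapSlots-first rewrite both-match {i} {b = j} refl = refl

    swapSlots-second : (i , j) ≢ (i′ , j′) → swapSlots k n r X i j i′ j′ i′ j′ ≡ X i j
    swapSlots-second ij≢i′j′ rewrite not-both-match (λ eq → ij≢i′j′ (sym eq)) | both-match {i′} {b = j′} refl = refl

    swapSlots-elsewhere : ∀ a b → (a , b) ≢ (i , j) → (a , b) ≢ (i′ , j′) → swapSlots k n r X i j i′ j′ a b ≡ X a b
    swapSlots-elsewhere a b ab≢ij ab≢i′j′ rewrite not-both-match ab≢ij | not-both-match ab≢i′j′ = refl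

  balanced-step : ∀ {X Y} → DeleteAdd k n r X Y → Balanced X → Balanced Y
  balanced-step (delAdd X i j i′ j′ Xij≢Xi′j′ σij≡T σi′j′≡T _) balanced x =
    trans (sym (∑∑-swap (weightAt X x) (weightAt Y x) ij≢i′j′ elsewhere swapped)) (balanced x)
    where
    open ≡-Reasoning
    Y : Config k n r
    Y = swapSlots k n r X i j i′ j′

    ij≢i′j′ : (i , j) ≢ (i′ , j′)
    ij≢i′j′ refl = Xij≢Xi′j′ refl

    targetIfAt : MVert n r → ℕ
    targetIfAt y = if does (decM n r y x) then target else 0

    weight≡target : ∀ Z a b → σ k n b a ≡ Tgt k n → weightAt Z x a b ≡ targetIfAt (Z a b)
    weight≡target Z a b σ≡T =
      cong (λ w → if does (decM n r (Z a b) x) then w else 0) (pos-injective (trans (sym (σ≡spokeSum b a)) σ≡T))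

    elsewhere : ∀ a b → (a , b) ≢ (i , j) → (a , b) ≢ (i′ , j′) → weightAt X x a b ≡ weightAt Y x a b
    elsewhere a b ab≢ij ab≢i′j′ =
      cong (λ y → if does (decM n r y x) then spokeSum a b else 0) (sym (swapSlots-elsewhere X i j i′ j′ a b ab≢ij ab≢i′j′))

    swapped : weightAt X x i j + weightAt X x i′ j′ ≡ weightAt Y x i j + weightAt Y x i′ j′
    swapped = begin
      weightAt X x i j + weightAt X x i′ j′
        ≡⟨ cong₂ _+_ (weight≡target X i j σij≡T) (weight≡target X i′ j′ σi′j′≡T) ⟩
      targetIfAt (X i j) + targetIfAt (X i′ j′)
        ≡⟨ +-comm (targetIfAt (X i j)) (targetIfAt (X i′ j′)) ⟩
      targetIfAt (X i′ j′) + targetIfAt (X i j)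
        ≡⟨ cong₂ (λ y y′ → targetIfAt y + targetIfAt y′)
                 (swapSlots-first X i j i′ j′) (swapSlots-second X i j i′ j′ ij≢i′j′) ⟨
      targetIfAt (Y i j) + targetIfAt (Y i′ j′)
        ≡⟨ cong₂ _+_ (weight≡target Y i j σij≡T) (weight≡target Y i′ j′ σi′j′≡T) ⟨
      weightAt Y x i j + weightAt Y x i′ j′  ∎

  balanced-reachable : ∀ {X} → InH k n r s X → Balanced X
  balanced-reachable (π , valid , steps) = closure-preserves Balanced balanced-step steps (balanced-init π valid)

  kinds : List EdgeKind
  kinds = uv ∷ cartesianProductWith (λ j side → spoke side j) (allFin (2 * n)) (u ∷ v ∷ [])

  names : List EdgeName
  names = cartesianProduct (allFin (W k)) kinds

  names! : Unique names
  names! = cartesianProduct⁺ (allFin⁺ (W k))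
                             (uv∉spokes ∷ cartesianProductWith⁺ _ spoke-injective (allFin⁺ (2 * n)) u∷v!)
    where
    open ListAll using ([]; _∷_)
    open AllPairs using ([]; _∷_)
    spoke-injective : ∀ {j j′ side side′} → spoke side j ≡ spoke side′ j′ → j ≡ j′ × side ≡ side′
    spoke-injective refl = refl , refl
    u∷v! : Unique (u ∷ v ∷ [])
    u∷v! = ((λ ()) ∷ []) ∷ [] ∷ []
    uv≢spoke : ∀ {x side j} → x ≡ spoke side j → uv ≢ x
    uv≢spoke refl ()
    uv∉spokes : All (uv ≢_) (cartesianProductWith (λ j side → spoke side j) (allFin (2 * n)) (u ∷ v ∷ []))
    uv∉spokes = ListAll.tabulate λ x∈ →
      let (_ , _ , _ , _ , x≡spoke) = ∈-cartesianProductWith⁻ (λ j side → spoke side j) (allFin (2 * n)) (u ∷ v ∷ []) x∈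
      in uv≢spoke x≡spoke

  length-names : length names ≡ W k * suc (2 * n * 2)
  length-names = begin
    length names                                       ≡⟨ length-cartesianProductWith _,_ (allFin (W k)) kinds ⟩
    length (allFin (W k)) * length kinds               ≡⟨ cong₂ (λ a b → a * suc b) (length-tabulate {n = W k} (λ i → i))
                                                           (trans (length-cartesianProductWith _ (allFin (2 * n)) (u ∷ v ∷ []))
                                                                  (cong (_* 2) (length-tabulate {n = 2 * n} (λ j → j)))) ⟩
    W k * suc (2 * n * 2)                              ∎
    where open ≡-Reasoning

  rank<length : ∀ a → rank a < length names
  rank<length a = subst (rank a <_) (sym length-names) (rank< a)

  module _ (X : Config k n r) where

    ends : EdgeName → VertH k n r × VertH k n r
    ends (i , uv)        = inj₁ i , inj₂ (inj₁ i)
    ends (i , spoke u j) = inj₁ i , inj₂ (inj₂ (X i j))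
    ends (i , spoke v j) = inj₂ (inj₁ i) , inj₂ (inj₂ (X i j))

    edges≡ : map ends names ≡ Graph.edges (graphOf k n r X)
    edges≡ = trans (map-cartesianProductWith ends _,_ (allFin (W k)) kinds)
                   (concatMap-cong (λ i → cong (ends (i , uv) ∷_)
                      (map-cartesianProductWith (λ a → ends (i , a)) (λ j side → spoke side j) (allFin (2 * n)) (u ∷ v ∷ [])))
                   (allFin (W k)))

    open NamedEdges (Graph._≟V_ (graphOf k n r X)) (Graph.vertices (graphOf k n r X)) ends names
    open Ranked names! rank rank-injective rank<length

    graphOf≡graph : graphOf k n r X ≡ graph
    graphOf≡graph = cong (λ E → record (graphOf k n r X) { edges = E }) (sym edges≡)

    private
      L : VertH k n r → EdgeName → ℕ
      L = incidentLabel

    rowSum : VertH k n r → Idx k → ℕ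
    rowSum w i = L w (i , uv) + ∑[ j < 2 * n ] (L w (i , spoke u j) + (L w (i , spoke v j) + 0))

    vsum≡rows : ∀ w → vsum graph rankLabeling w ≡ ∑[ i < W k ] rowSum w i
    vsum≡rows w = begin
      vsum graph rankLabeling w
        ≡⟨ vsum-rankLabeling w ⟩
      List.sum (map (L w) names)
        ≡⟨ cong List.sum (map-cartesianProductWith (L w) _,_ (allFin (W k)) kinds) ⟩
      List.sum (concatMap (λ i → map (λ κ → L w (i , κ)) kinds) (allFin (W k)))
        ≡⟨ sum-concatMap (λ i → map (λ κ → L w (i , κ)) kinds) (allFin (W k)) ⟩
      List.sum (map (λ i → List.sum (map (λ κ → L w (i , κ)) kinds)) (allFin (W k)))
        ≡⟨ sum-allFin (W k) _ ⟩
      ∑[ i < W k ] List.sum (map (λ κ → L w (i , κ)) kinds)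
        ≡⟨ sum-cong-≗ {W k} row ⟩
      ∑[ i < W k ] rowSum w i  ∎
      where
      open ≡-Reasoning
      row : ∀ i → List.sum (map (λ κ → L w (i , κ)) kinds) ≡ rowSum w i
      row i = cong (_+_ (L w (i , uv))) (begin
        List.sum (map (λ κ → L w (i , κ)) (cartesianProductWith (λ j side → spoke side j) (allFin (2 * n)) (u ∷ v ∷ [])))
          ≡⟨ cong List.sum (map-cartesianProductWith (λ κ → L w (i , κ)) (λ j side → spoke side j)
                                                     (allFin (2 * n)) (u ∷ v ∷ [])) ⟩
        List.sum (concatMap (λ j → L w (i , spoke u j) ∷ L w (i , spoke v j) ∷ []) (allFin (2 * n)))
          ≡⟨ sum-concatMap (λ j → L w (i , spoke u j) ∷ L w (i , spoke v j) ∷ []) (allFin (2 * n)) ⟩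
        List.sum (map (λ j → L w (i , spoke u j) + (L w (i , spoke v j) + 0)) (allFin (2 * n)))
          ≡⟨ sum-allFin (2 * n) _ ⟩
        ∑[ j < 2 * n ] (L w (i , spoke u j) + (L w (i , spoke v j) + 0))  ∎)

    vsum-u : 1 ≤ n → ∀ i₀ → vsum graph rankLabeling (inj₁ i₀) ≡ rowTotal u n
    vsum-u n≥1 i₀ = begin
      vsum graph rankLabeling w                                  ≡⟨ vsum≡rows w ⟩
      ∑[ i < W k ] rowSum w i                                    ≡⟨ sum-single (rowSum w) i₀ other ⟩
      rowSum w i₀                                                ≡⟨ cong₂ _+_ rung (sum-cong-≗ {2 * n} spokes) ⟩
      suc (toℕ i₀) + ∑[ j < 2 * n ] suc (rank (i₀ , spoke u j))  ≡⟨ rung+spokes n≥1 u i₀ ⟩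
      rowTotal u n                                               ∎
      where
      open ≡-Reasoning
      w : VertH k n r
      w = inj₁ i₀
      rung : L w (i₀ , uv) ≡ suc (toℕ i₀)
      rung = trans (incidentLabel-fst w (i₀ , uv) refl) (cong suc (+-identityʳ (toℕ i₀)))
      spokes : ∀ j → L w (i₀ , spoke u j) + (L w (i₀ , spoke v j) + 0) ≡ suc (rank (i₀ , spoke u j))
      spokes j = trans (cong₂ _+_ (incidentLabel-fst w (i₀ , spoke u j) refl)
                                  (cong (_+ 0) (incidentLabel-off w (i₀ , spoke v j) (λ ()) (λ ()))))
                       (+-identityʳ _)
      other : ∀ i → i ≢ i₀ → rowSum w i ≡ 0
      other i i≢i₀ = cong₂ _+_ (incidentLabel-off w (i , uv) w≢ (λ ()))
                               (sum-zero _ (λ j → cong₂ _+_ (incidentLabel-off w (i , spoke u j) w≢ (λ ()))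
                                                            (cong (_+ 0) (incidentLabel-off w (i , spoke v j) (λ ()) (λ ())))))
        where
        w≢ : w ≢ inj₁ i
        w≢ eq = i≢i₀ (sym (inj₁-injective eq))

    vsum-v : 1 ≤ n → ∀ i₀ → vsum graph rankLabeling (inj₂ (inj₁ i₀)) ≡ rowTotal v n
    vsum-v n≥1 i₀ = begin
      vsum graph rankLabeling w                                  ≡⟨ vsum≡rows w ⟩
      ∑[ i < W k ] rowSum w i                                    ≡⟨ sum-single (rowSum w) i₀ other ⟩
      rowSum w i₀                                                ≡⟨ cong₂ _+_ rung (sum-cong-≗ {2 * n} spokes) ⟩
      suc (toℕ i₀) + ∑[ j < 2 * n ] suc (rank (i₀ , spoke v j))  ≡⟨ rung+spokes n≥1 v i₀ ⟩
      rowTotal v n                                               ∎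
      where
      open ≡-Reasoning
      w : VertH k n r
      w = inj₂ (inj₁ i₀)
      rung : L w (i₀ , uv) ≡ suc (toℕ i₀)
      rung = trans (incidentLabel-snd w (i₀ , uv) refl) (cong suc (+-identityʳ (toℕ i₀)))
      spokes : ∀ j → L w (i₀ , spoke u j) + (L w (i₀ , spoke v j) + 0) ≡ suc (rank (i₀ , spoke v j))
      spokes j = trans (cong₂ _+_ (incidentLabel-off w (i₀ , spoke u j) (λ ()) (λ ()))
                                  (cong (_+ 0) (incidentLabel-fst w (i₀ , spoke v j) refl)))
                       (+-identityʳ _)
      other : ∀ i → i ≢ i₀ → rowSum w i ≡ 0
      other i i≢i₀ = cong₂ _+_ (incidentLabel-off w (i , uv) (λ ()) w≢)
                               (sum-zero _ (λ j → cong₂ _+_ (incidentLabel-off w (i , spoke u j) (λ ()) (λ ()))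
                                                            (cong (_+ 0) (incidentLabel-off w (i , spoke v j) w≢ (λ ())))))
        where
        w≢ : w ≢ inj₂ (inj₁ i)
        w≢ eq = i≢i₀ (sym (inj₁-injective (inj₂-injective eq)))

    vsum-merged : ∀ x → vsum graph rankLabeling (inj₂ (inj₂ x)) ≡ mergedSum X x
    vsum-merged x = trans (vsum≡rows w) (sum-cong-≗ {W k} row)
      where
      w : VertH k n r
      w = inj₂ (inj₂ x)
      spokes : ∀ i j → L w (i , spoke u j) + (L w (i , spoke v j) + 0) ≡ weightAt X x i j
      spokes i j with decM n r (X i j) x
      ... | yes Xij≡x = trans (cong₂ _+_ (incidentLabel-snd w (i , spoke u j) (cong (inj₂ ∘ inj₂) Xij≡x))
                                         (cong (_+ 0) (incidentLabel-snd w (i , spoke v j) (cong (inj₂ ∘ inj₂) Xij≡x))))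
                              (cong (_+_ (suc (rank (i , spoke u j)))) (+-identityʳ _))
      ... | no Xij≢x  = cong₂ _+_ (incidentLabel-off w (i , spoke u j) (λ ()) w≢)
                                  (cong (_+ 0) (incidentLabel-off w (i , spoke v j) (λ ()) w≢))
        where
        w≢ : w ≢ inj₂ (inj₂ (X i j))
        w≢ eq = Xij≢x (sym (inj₂-injective (inj₂-injective eq)))
      row : ∀ i → rowSum w i ≡ ∑[ j < 2 * n ] weightAt X x i j
      row i = cong₂ _+_ (incidentLabel-off w (i , uv) (λ ()) (λ ())) (sum-cong-≗ {2 * n} (spokes i))

    value : VertH k n r → ℕ
    value (inj₁ _)        = rowTotal u n
    value (inj₂ (inj₁ _)) = rowTotal v n
    value (inj₂ (inj₂ _)) = suc (2 * s) * target

    vsum≡value : 1 ≤ n → Balanced X → ∀ w → vsum graph rankLabeling w ≡ value w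
    vsum≡value n≥1 _        (inj₁ i)        = vsum-u n≥1 i
    vsum≡value n≥1 _        (inj₂ (inj₁ i)) = vsum-v n≥1 i
    vsum≡value _   balanced (inj₂ (inj₂ x)) = trans (vsum-merged x) (balanced x)

    rung-u∈ : ∀ i → inj₁ i ∈ Graph.vertices graph
    rung-u∈ i = ∈-++⁺ˡ (∈-map⁺ inj₁ (∈-allFin i))

    rung-v∈ : ∀ i → inj₂ (inj₁ i) ∈ Graph.vertices graph
    rung-v∈ i = ∈-++⁺ʳ (map inj₁ (allFin (W k))) (∈-++⁺ˡ (∈-map⁺ (λ i → inj₂ (inj₁ i)) (∈-allFin i)))

    merged∈ : ∀ x → inj₂ (inj₂ x) ∈ Graph.vertices graph
    merged∈ (j , b) = ∈-++⁺ʳ (map inj₁ (allFin (W k))) (∈-++⁺ʳ (map (λ i → inj₂ (inj₁ i)) (allFin (W k)))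
                        (∈-map⁺ (λ x → inj₂ (inj₂ x)) (∈-cartesianProduct⁺ (∈-allFin j) (∈-allFin b))))

    values-apart : 2 ≤ n → ∀ a → value (proj₁ (ends a)) ≢ value (proj₂ (ends a))
    values-apart n≥2 (_ , uv)        = rowTotal-u≢v (≤-trans (s≤s z≤n) n≥2)
    values-apart _   (_ , spoke u _) = rowTotal-u≢multiple (suc (2 * s))
    values-apart n≥2 (_ , spoke v _) = rowTotal-v≢multiple n≥2 (suc (2 * s))

    rankLabeling-antimagic : 2 ≤ n → Balanced X → IsLocalAntimagic graph rankLabeling
    rankLabeling-antimagic n≥2 balanced =
      antimagic-by-values value (vsum≡value (≤-trans (s≤s z≤n) n≥2) balanced) (values-apart n≥2)

    rankLabeling-numValues : 2 ≤ n → Balanced X → numValues graph rankLabeling ≡ 3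
    rankLabeling-numValues n≥2@(s≤s (s≤s z≤n)) balanced =
      numValues≡3 graph rankLabeling (rung-u∈ zero) (rung-v∈ zero) (merged∈ x)
                  (apart {u₀} {v₀} (values-apart n≥2 (zero , uv)))
                  (apart {u₀} {x₀} (values-apart n≥2 (zero , spoke u zero)))
                  (apart {v₀} {x₀} (values-apart n≥2 (zero , spoke v zero))) range
      where
      x : MVert n r
      x = X zero zero
      u₀ v₀ x₀ : VertH k n r
      u₀ = inj₁ zero
      v₀ = inj₂ (inj₁ zero)
      x₀ = inj₂ (inj₂ x)
      vsum≡value′ : ∀ w → vsum graph rankLabeling w ≡ value w
      vsum≡value′ = vsum≡value (s≤s z≤n) balanced
      apart : ∀ {w w′} → value w ≢ value w′ → vsum graph rankLabeling w ≢ vsum graph rankLabeling w′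
      apart {w} {w′} value≢ eq = value≢ (trans (sym (vsum≡value′ w)) (trans eq (vsum≡value′ w′)))
      range : ∀ w → vsum graph rankLabeling w ∈ map (vsum graph rankLabeling) (u₀ ∷ v₀ ∷ x₀ ∷ [])
      range w@(inj₁ _)        = here (trans (vsum≡value′ w) (sym (vsum≡value′ u₀)))
      range w@(inj₂ (inj₁ _)) = there (here (trans (vsum≡value′ w) (sym (vsum≡value′ v₀))))
      range w@(inj₂ (inj₂ _)) = there (there (here (trans (vsum≡value′ w) (sym (vsum≡value′ x₀)))))

    3≤numValues : 2 ≤ n → ∀ f → IsLocalAntimagic graph f → 3 ≤ numValues graph f
    3≤numValues (s≤s (s≤s z≤n)) f =
      triangle⇒3≤numValues graph f zero (suc zero) (suc (suc zero)) refl refl refl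
                           (rung-u∈ zero) (rung-v∈ zero) (merged∈ (X zero zero))

    χla≡3 : 2 ≤ n → Balanced X → χla≡ graph 3
    χla≡3 n≥2 balanced =
      (rankLabeling , rankLabeling-antimagic n≥2 balanced , rankLabeling-numValues n≥2 balanced) , 3≤numValues n≥2

theorem2p6 : (n r s k : ℕ) → 2 ≤ n → 1 ≤ r → 1 ≤ s → k ≡ 2 * r * s + r + s →
    (X : Config k n r) → InH k n r s X →
    χla≡ (graphOf k n r X) 3
-- The conditions on r, s and k only serve to make 𝒢 non-empty.
theorem2p6 n r s k n≥2 _ _ _ X inH =
  subst (λ G → χla≡ G 3) (sym (graphOf≡graph X)) (χla≡3 X n≥2 (balanced-reachable inH))
  where open Merged k n r s
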